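{- Let $a,b\ge1$ and let $K_{a,b}$ be the complete bipartite graph with vertices $v_1,\dots,v_a,w_1,\dots,w_b$ and edges $\{v_i,w_j\}$ for all $i,j$. Then $f\colon V\to\mathbb{Z}$ is facet defining for $P_{K_{a,b}}$ if and only if, up to adding a constant, either (i) $f(v_i)=0$ for all $i$ and $f(w_j)\in\{ -1,1\}$ for all $j$, or (ii) $f(w_j)=0$ for all $j$ and $f(v_i)\in\{ -1,1\}$ for all $i$. In particular, $P_{K_{a,b}}$ has $2^a+2^b-2$ facets.
   Context: $P_G=\mathrm{conv}(e_v-e_w,\,e_w-e_v : vw\in E)\subset\mathbb{R}^V$. Functions $V\to\mathbb{Z}$ are considered up to adding a common constant. $f$ is facet defining if $\sum_v f(v)x_v\le1$ on $P_G$ and $\{x\in P_G:\sum_v f(v)x_v=1\}$ is a facet of $P_G$.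
   Formalization: The polytope $P_G$ lies in ℚ^V instead of ℝ^V, so its points, valid inequalities, faces, dimensions and facets are taken over the rationals. -}

module Defs where

open import Data.Nat using (ℕ; zero; suc; _+_)
open import Data.Fin using (Fin; zero; suc; _↑ˡ_; _↑ʳ_)
open import Data.Integer as ℤ using (ℤ)
open import Data.Rational as ℚ using (ℚ; 0ℚ; 1ℚ)
open import Data.Product using (Σ; ∃; _×_; _,_)
open import Data.Sum using (_⊎_)
open import Relation.Binary.PropositionalEquality using (_≡_; _≢_)
open import Relation.Nullary using (¬_; yes; no)
open import Level using (0ℓ)
open import Relation.Binary.Core using (Rel)

Vecℚ : ℕ → Set
Vecℚ n = Fin n → ℚ

Σℚ : ∀ {k} → (Fin k → ℚ) → ℚ
Σℚ {zero}  f = 0ℚ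
Σℚ {suc k} f = f zero ℚ.+ Σℚ (λ i → f (suc i))

e : ∀ {n} → Fin n → Vecℚ n
e v u with v Data.Fin.≟ u
... | yes _ = 1ℚ
... | no  _ = 0ℚ

_-ᵛ_ : ∀ {n} → Vecℚ n → Vecℚ n → Vecℚ n
(x -ᵛ y) u = x u ℚ.- y u

lincomb : ∀ {n k} → (Fin k → ℚ) → (Fin k → Vecℚ n) → Vecℚ n
lincomb c p u = Σℚ (λ i → c i ℚ.* p i u)

⟨_,_⟩ : ∀ {n} → Vecℚ n → Vecℚ n → ℚ
⟨ h , x ⟩ = Σℚ (λ v → h v ℚ.* x v)

toℚᵛ : ∀ {n} → (Fin n → ℤ) → Vecℚ n
toℚᵛ f v = f v ℚ./ 1

-- Graphs on vertex set Fin n, given by an (undirected) edge relation: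
-- vw ∈ E iff Edge v w ⊎ Edge w v.

Graph : ℕ → Set₁
Graph n = Fin n → Fin n → Set

Generator : ∀ {n} → Graph n → Vecℚ n → Set
Generator G x = Σ _ λ v → Σ _ λ w → (G v w ⊎ G w v) × (x ≡ (e v -ᵛ e w))

P : ∀ {n} → Graph n → Vecℚ n → Set
P G x = Σ ℕ λ k → Σ (Fin k → ℚ) λ c → Σ (Fin k → Vecℚ _) λ p →
  ((i : Fin k) → 0ℚ ℚ.≤ c i) × (Σℚ c ≡ 1ℚ) × ((i : Fin k) → Generator G (p i)) ×
  (∀ u → x u ≡ lincomb c p u)

AffIndep : ∀ {n k} → (Fin k → Vecℚ n) → Set
AffIndep {n} {k} p = (c : Fin k → ℚ) → Σℚ c ≡ 0ℚ → (∀ u → lincomb c p u ≡ 0ℚ) →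
  ∀ i → c i ≡ 0ℚ

HasAffIndep : ∀ {n} → (Vecℚ n → Set) → ℕ → Set
HasAffIndep S m = Σ (Fin m → Vecℚ _) λ p → ((i : Fin m) → S (p i)) × AffIndep p

AffDim : ∀ {n} → (Vecℚ n → Set) → ℕ → Set
AffDim S d = HasAffIndep S (suc d) × ¬ HasAffIndep S (suc (suc d))

Face : ∀ {n} → (Vecℚ n → Set) → Vecℚ n → ℚ → Vecℚ n → Set
Face Q h β x = Q x × ⟨ h , x ⟩ ≡ β

Valid : ∀ {n} → (Vecℚ n → Set) → Vecℚ n → ℚ → Set
Valid Q h β = ∀ x → Q x → ⟨ h , x ⟩ ℚ.≤ β

DefinesFacet : ∀ {n} → (Vecℚ n → Set) → Vecℚ n → ℚ → Set
DefinesFacet Q h β = Valid Q h β ×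
  Σ ℕ λ d → AffDim Q (suc d) × AffDim (Face Q h β) d

IsFacet : ∀ {n} → (Vecℚ n → Set) → (Vecℚ n → Set) → Set
IsFacet Q F = Σ (Vecℚ _) λ h → Σ ℚ λ β → DefinesFacet Q h β ×
  (∀ x → (F x → Face Q h β x) × (Face Q h β x → F x))

FacetDefining : ∀ {n} → Graph n → (Fin n → ℤ) → Set
FacetDefining G f = DefinesFacet (P G) (toℚᵛ f) 1ℚ

SameSet : ∀ {n} → (Vecℚ n → Set) → (Vecℚ n → Set) → Set
SameSet A B = ∀ x → (A x → B x) × (B x → A x)

HasNFacets : ∀ {n} → (Vecℚ n → Set) → ℕ → Set₁
HasNFacets Q N = Σ (Fin N → (Vecℚ _ → Set)) λ F →
  ((i : Fin N) → IsFacet Q (F i)) ×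
  ((i j : Fin N) → SameSet (F i) (F j) → i ≡ j) ×
  ((G : Vecℚ _ → Set) → IsFacet Q G → Σ (Fin N) λ i → SameSet G (F i))

-- Complete bipartite graph K_{a,b} on Fin (a + b):
-- v_i = i ↑ˡ b  (i : Fin a),  w_j = a ↑ʳ j  (j : Fin b)

vtx : ∀ {a} b → Fin a → Fin (a + b)
vtx b i = i ↑ˡ b

wtx : ∀ a {b} → Fin b → Fin (a + b)
wtx a j = a ↑ʳ j

K : (a b : ℕ) → Graph (a + b)
K a b x y = Σ (Fin a) λ i → Σ (Fin b) λ j → (x ≡ vtx b i) × (y ≡ wtx a j)

-- P = P_{K_{a,b}} lies in the hyperplane Σ x = 0 and contains 0 and the edge vectors of a
-- spanning tree, so dim P = a + b - 1. A valid inequality ⟨ h , x ⟩ ≤ β with β ≠ 0 has as face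
-- the convex hull of its tight edge vectors e_x - e_y (h x - h y = β). If every edge has a tight
-- orientation, the tight vectors along the spanning tree give a + b - 1 affinely independent
-- points on the face, which is then a facet. Conversely, a functional C constant along all tight
-- edges vanishes on the face together with the all-ones functional, so on a facet C is constant.
-- Taking for C the indicators of single vertices and of the extremal level set
-- {v : h v = max h|V} ∪ {w : h w = min h|W} forces h to be constant on one side and to take the
-- values (constant ± β) on the other: for β = 1 this is the normal form (i) or (ii). Distinct
-- normal forms have distinct faces, except that the two constant sign vectors of (ii) give the
-- same faces as constant ones of (i), whence 2^b + (2^a - 2) facets.

module Submission where

open import Defs
open import Data.Nat as ℕ using (ℕ; zero; suc; _^_; _∸_; _≥_; z≤n; s≤s)
import Data.Nat.Properties as ℕ
open import Data.Fin as Fin using (Fin; zero; suc; punchIn; punchOut; _↑ˡ_; _↑ʳ_)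
import Data.Fin.Properties as Fin
open import Data.Product using (Σ; ∃; _×_; _,_; proj₁; proj₂)
open import Data.Sum using (_⊎_; inj₁; inj₂)
open import Data.Empty using (⊥; ⊥-elim)
open import Function using (_∘_; id; _⇔_; mk⇔)
open import Function.Construct.Composition using (_⇔-∘_)
open import Relation.Binary.PropositionalEquality
open import Relation.Nullary using (¬_; yes; no; Dec; contradiction)

module FinCodes where

  private variable
    m n : ℕ

  funToFin-cong : {f g : Fin m → Fin n} → (∀ i → f i ≡ g i) → Fin.funToFin f ≡ Fin.funToFin g
  funToFin-cong {zero}  f≗g = refl
  funToFin-cong {suc m} f≗g = cong₂ Fin.combine (f≗g zero) (funToFin-cong (f≗g ∘ suc))

  finToFun-injective : (k k′ : Fin (n ^ m)) → (∀ i → Fin.finToFun {n} {m} k i ≡ Fin.finToFun k′ i) → k ≡ k′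
  finToFun-injective {n} {m} k k′ eq =
    trans (sym (Fin.funToFin-finToFin {m} {n} k)) (trans (funToFin-cong eq) (Fin.funToFin-finToFin {m} {n} k′))

  module TwoPunctures {k₀ k₁ : Fin (suc (suc m))} (k₀≢k₁ : k₀ ≢ k₁) where

    punchIn₂ : Fin m → Fin (suc (suc m))
    punchIn₂ j = punchIn k₀ (punchIn (punchOut k₀≢k₁) j)

    punchIn₂-injective : ∀ j j′ → punchIn₂ j ≡ punchIn₂ j′ → j ≡ j′
    punchIn₂-injective j j′ eq = Fin.punchIn-injective _ j j′ (Fin.punchIn-injective k₀ _ _ eq)

    punchIn₂≢k₀ : ∀ j → punchIn₂ j ≢ k₀
    punchIn₂≢k₀ j = Fin.punchInᵢ≢i k₀ _

    punchIn₂≢k₁ : ∀ j → punchIn₂ j ≢ k₁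
    punchIn₂≢k₁ j eq = Fin.punchInᵢ≢i (punchOut k₀≢k₁) j
      (Fin.punchIn-injective k₀ _ _ (trans eq (sym (Fin.punchIn-punchOut k₀≢k₁))))

    punchIn₂-surjective : ∀ k → k₀ ≢ k → k₁ ≢ k → ∃ λ j → punchIn₂ j ≡ k
    punchIn₂-surjective k k₀≢k k₁≢k = punchOut k₁′≢k′ , trans (cong (punchIn k₀) (Fin.punchIn-punchOut k₁′≢k′))
                                                              (Fin.punchIn-punchOut k₀≢k)
      where
      k₁′≢k′ : punchOut k₀≢k₁ ≢ punchOut k₀≢k
      k₁′≢k′ eq = k₁≢k (trans (sym (Fin.punchIn-punchOut k₀≢k₁))
                              (trans (cong (punchIn k₀) eq) (Fin.punchIn-punchOut k₀≢k)))

module Rationals where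

  open import Data.Rational public using (ℚ; 0ℚ; 1ℚ; ½; _+_; _*_; _-_; -_; _≤_)
  open import Data.Rational using (1/_; NonZero; ≢-nonZero; nonNegative)
  open import Data.Rational.Properties
  open import Relation.Nullary.Decidable using (dec⇒maybe)
  import Tactic.RingSolver.Core.AlmostCommutativeRing as ACR
  open import Algebra.Properties.Group +-0-group using (x∙y⁻¹≈ε⇒x≈y; x≈y⇒x∙y⁻¹≈ε)
  open import Tactic.RingSolver using (solve-∀)

  ℚ-ring : ACR.AlmostCommutativeRing _ _
  ℚ-ring = ACR.fromCommutativeRing +-*-commutativeRing (λ x → dec⇒maybe (0ℚ ≟ x))

  -1≢0 : - 1ℚ ≢ 0ℚ
  -1≢0 ()

  0≤1 : 0ℚ ≤ 1ℚ
  0≤1 = nonNegative⁻¹ 1ℚ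

  0≤½ : 0ℚ ≤ ½
  0≤½ = nonNegative⁻¹ ½

  -1≤1 : - 1ℚ ≤ 1ℚ
  -1≤1 = ≤-trans (nonPositive⁻¹ (- 1ℚ)) 0≤1

  p-q≡0⇒p≡q : ∀ {p q} → p - q ≡ 0ℚ → p ≡ q
  p-q≡0⇒p≡q {p} {q} = x∙y⁻¹≈ε⇒x≈y p q

  p≡q⇒p-q≡0 : ∀ {p q} → p ≡ q → p - q ≡ 0ℚ
  p≡q⇒p-q≡0 = x≈y⇒x∙y⁻¹≈ε

  reverse-difference : ∀ x y {r} → x - y ≡ r → y - x ≡ - r
  reverse-difference x y refl = flip x y
    where
    flip : ∀ x y → y - x ≡ - (x - y)
    flip = solve-∀ ℚ-ring

  x≡x+y*0 : ∀ x y → x ≡ x + y * 0ℚ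
  x≡x+y*0 = solve-∀ ℚ-ring

  p-q≡r⇒q≡p-r : ∀ p q {r} → p - q ≡ r → q ≡ p - r
  p-q≡r⇒q≡p-r p q refl = solve p q
    where
    solve : ∀ p q → q ≡ p - (p - q)
    solve = solve-∀ ℚ-ring

  q-p≡r⇒q≡p+r : ∀ p q {r} → q - p ≡ r → q ≡ p + r
  q-p≡r⇒q≡p+r p q refl = solve p q
    where
    solve : ∀ p q → q ≡ p + (q - p)
    solve = solve-∀ ℚ-ring

  p*q≡0⇒q≡0 : ∀ {p q} → p ≢ 0ℚ → p * q ≡ 0ℚ → q ≡ 0ℚ
  p*q≡0⇒q≡0 {p} {q} p≢0 pq≡0 = begin
    q                ≡⟨ *-identityˡ q ⟨
    1ℚ * q           ≡⟨ cong (_* q) (*-inverseˡ p) ⟨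
    (1/ p) * p * q   ≡⟨ *-assoc (1/ p) p q ⟩
    (1/ p) * (p * q) ≡⟨ cong ((1/ p) *_) pq≡0 ⟩
    (1/ p) * 0ℚ      ≡⟨ *-zeroʳ (1/ p) ⟩
    0ℚ               ∎
    where
    open ≡-Reasoning
    instance
      p-nonZero : NonZero p
      p-nonZero = ≢-nonZero p≢0

  p≤q⇒0≤q-p : ∀ {p q} → p ≤ q → 0ℚ ≤ q - p
  p≤q⇒0≤q-p {p} le = ≤-trans (≤-reflexive (sym (+-inverseʳ p))) (+-monoˡ-≤ (- p) le)

  nonNeg+nonNeg≡0⇒≡0 : ∀ {p q} → 0ℚ ≤ p → 0ℚ ≤ q → p + q ≡ 0ℚ → p ≡ 0ℚ
  nonNeg+nonNeg≡0⇒≡0 {p} 0≤p 0≤q p+q≡0 =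
    ≤-antisym (≤-trans (≤-reflexive (sym (+-identityʳ p))) (≤-trans (+-monoʳ-≤ p 0≤q) (≤-reflexive p+q≡0))) 0≤p

  private
    ≤-shift : ∀ {p q} r {p′ q′} → p ≤ q → p + r ≡ p′ → q + r ≡ q′ → p′ ≤ q′
    ≤-shift r p≤q refl refl = +-monoˡ-≤ r p≤q

  -cancelʳ-≤ : ∀ {p q r} → p - r ≤ q - r → p ≤ q
  -cancelʳ-≤ {p} {q} {r} le = ≤-shift r le (sub-add p r) (sub-add q r)
    where
    sub-add : ∀ p r → p - r + r ≡ p
    sub-add = solve-∀ ℚ-ring

  -cancelˡ-≤ : ∀ {p q r} → r - p ≤ r - q → q ≤ p
  -cancelˡ-≤ {p} {q} {r} le = ≤-shift (p + q - r) le (shiftˡ p q r) (shiftʳ p q r)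
    where
    shiftˡ : ∀ p q r → r - p + (p + q - r) ≡ q
    shiftˡ = solve-∀ ℚ-ring
    shiftʳ : ∀ p q r → r - q + (p + q - r) ≡ p
    shiftʳ = solve-∀ ℚ-ring

  p-q≤0⇒p≤q : ∀ {p q} → p - q ≤ 0ℚ → p ≤ q
  p-q≤0⇒p≤q {p} {q} le = -cancelʳ-≤ (≤-trans le (≤-reflexive (sym (+-inverseʳ q))))

  squeeze : ∀ {x y M m} → x ≤ M → m ≤ y → M - m ≤ x - y → x ≡ M × y ≡ m
  squeeze {x} {y} {M} {m} x≤M m≤y gap = sym (p-q≡0⇒p≡q [M-x]≡0) , p-q≡0⇒p≡q [y-m]≡0
    where
    regroup : ∀ M x y m → (M - x) + (y - m) ≡ (M - m) - (x - y)
    regroup = solve-∀ ℚ-ring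
    Σslack≡0 : (M - x) + (y - m) ≡ 0ℚ
    Σslack≡0 = ≤-antisym
      (≤-trans (≤-reflexive (regroup M x y m)) (≤-shift (- (x - y)) gap refl (+-inverseʳ (x - y))))
      (+-mono-≤ (p≤q⇒0≤q-p x≤M) (p≤q⇒0≤q-p m≤y))
    [M-x]≡0 : M - x ≡ 0ℚ
    [M-x]≡0 = nonNeg+nonNeg≡0⇒≡0 (p≤q⇒0≤q-p x≤M) (p≤q⇒0≤q-p m≤y) Σslack≡0
    [y-m]≡0 : y - m ≡ 0ℚ
    [y-m]≡0 = nonNeg+nonNeg≡0⇒≡0 (p≤q⇒0≤q-p m≤y) (p≤q⇒0≤q-p x≤M) (trans (+-comm (y - m) (M - x)) Σslack≡0)

  *-monoˡ-≤-nonNeg′ : ∀ {r p q} → 0ℚ ≤ r → p ≤ q → r * p ≤ r * q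
  *-monoˡ-≤-nonNeg′ {r} 0≤r = *-monoˡ-≤-nonNeg r {{nonNegative 0≤r}}

  nonNeg*nonNeg : ∀ {p q} → 0ℚ ≤ p → 0ℚ ≤ q → 0ℚ ≤ p * q
  nonNeg*nonNeg {p} {q} 0≤p 0≤q =
    nonNegative⁻¹ _ {{nonNeg*nonNeg⇒nonNeg p {{nonNegative 0≤p}} q {{nonNegative 0≤q}}}}

  𝟙 : {A : Set} → Dec A → ℚ
  𝟙 (yes _) = 1ℚ
  𝟙 (no _)  = 0ℚ

  𝟙-yes : ∀ {p q} → p ≡ q → 𝟙 (p ≟ q) ≡ 1ℚ
  𝟙-yes {p} {q} p≡q with p ≟ q
  ... | yes _   = refl
  ... | no p≢q  = contradiction p≡q p≢q

  𝟙-no : ∀ {p q} → p ≢ q → 𝟙 (p ≟ q) ≡ 0ℚ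
  𝟙-no {p} {q} p≢q with p ≟ q
  ... | yes p≡q = contradiction p≡q p≢q
  ... | no _    = refl

  avoids : ∀ {A : Set} (f : A → ℚ) {x y} → f x ≢ f y → ∀ z → ∃ λ w → f w ≢ z
  avoids f {x} {y} fx≢fy z with f y ≟ z
  ... | yes fy≡z = x , λ fx≡z → fx≢fy (trans fx≡z (sym fy≡z))
  ... | no fy≢z  = y , fy≢z

  argmax : ∀ {k} (f : Fin (suc k) → ℚ) → ∃ λ i → ∀ j → f j ≤ f i
  argmax {zero}  f = zero , λ { zero → ≤-refl }
  argmax {suc k} f with argmax (f ∘ suc)
  ... | i , ≤fi with ≤-total (f zero) (f (suc i))
  ... | inj₁ f0≤ = suc i , λ { zero → f0≤ ; (suc j) → ≤fi j }
  ... | inj₂ ≤f0 = zero  , λ { zero → ≤-refl ; (suc j) → ≤-trans (≤fi j) ≤f0 }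

  argmin : ∀ {k} (f : Fin (suc k) → ℚ) → ∃ λ i → ∀ j → f i ≤ f j
  argmin {zero}  f = zero , λ { zero → ≤-refl }
  argmin {suc k} f with argmin (f ∘ suc)
  ... | i , fi≤ with ≤-total (f zero) (f (suc i))
  ... | inj₁ f0≤ = zero  , λ { zero → ≤-refl ; (suc j) → ≤-trans f0≤ (fi≤ j) }
  ... | inj₂ ≤f0 = suc i , λ { zero → ≤f0 ; (suc j) → fi≤ j }

module Sums where

  open Rationals
  open import Data.Rational.Properties
  open import Tactic.RingSolver using (solve-∀)
  open ≡-Reasoning

  Σℚ-cong : ∀ {k} {f g : Fin k → ℚ} → (∀ i → f i ≡ g i) → Σℚ f ≡ Σℚ g
  Σℚ-cong {zero}  eq = refl
  Σℚ-cong {suc k} eq = cong₂ _+_ (eq zero) (Σℚ-cong (eq ∘ suc))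

  Σℚ-zero : ∀ {k} {f : Fin k → ℚ} → (∀ i → f i ≡ 0ℚ) → Σℚ f ≡ 0ℚ
  Σℚ-zero {zero}  eq = refl
  Σℚ-zero {suc k} eq = cong₂ _+_ (eq zero) (Σℚ-zero (eq ∘ suc))

  Σℚ-+ : ∀ {k} (f g : Fin k → ℚ) → Σℚ (λ i → f i + g i) ≡ Σℚ f + Σℚ g
  Σℚ-+ {zero}  f g = refl
  Σℚ-+ {suc k} f g = trans (cong (f zero + g zero +_) (Σℚ-+ (f ∘ suc) (g ∘ suc)))
                           (interchange (f zero) (g zero) _ _)
    where
    interchange : ∀ a b c d → (a + b) + (c + d) ≡ (a + c) + (b + d)
    interchange = solve-∀ ℚ-ring

  Σℚ-*ˡ : ∀ {k} (a : ℚ) (f : Fin k → ℚ) → Σℚ (λ i → a * f i) ≡ a * Σℚ f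
  Σℚ-*ˡ {zero}  a f = sym (*-zeroʳ a)
  Σℚ-*ˡ {suc k} a f = trans (cong (a * f zero +_) (Σℚ-*ˡ a (f ∘ suc))) (sym (*-distribˡ-+ a (f zero) _))

  Σℚ-*ʳ : ∀ {k} (a : ℚ) (f : Fin k → ℚ) → Σℚ (λ i → f i * a) ≡ Σℚ f * a
  Σℚ-*ʳ a f = trans (Σℚ-cong (λ i → *-comm (f i) a)) (trans (Σℚ-*ˡ a f) (*-comm a _))

  Σℚ-neg : ∀ {k} (f : Fin k → ℚ) → Σℚ (λ i → - f i) ≡ - Σℚ f
  Σℚ-neg {zero}  f = refl
  Σℚ-neg {suc k} f = trans (cong (- f zero +_) (Σℚ-neg (f ∘ suc))) (sym (neg-distrib-+ (f zero) _))

  Σℚ-- : ∀ {k} (f g : Fin k → ℚ) → Σℚ (λ i → f i - g i) ≡ Σℚ f - Σℚ g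
  Σℚ-- f g = trans (Σℚ-+ f (λ i → - g i)) (cong (Σℚ f +_) (Σℚ-neg g))

  Σℚ-swap : ∀ {k m} (F : Fin k → Fin m → ℚ) → Σℚ (λ i → Σℚ (F i)) ≡ Σℚ (λ j → Σℚ (λ i → F i j))
  Σℚ-swap {zero} {m} F = sym (Σℚ-zero {m} (λ _ → refl))
  Σℚ-swap {suc k} F = trans (cong (Σℚ (F zero) +_) (Σℚ-swap (F ∘ suc)))
                            (sym (Σℚ-+ (F zero) (λ j → Σℚ (λ i → F (suc i) j))))

  Σℚ-punchIn : ∀ {k} (f : Fin (suc k) → ℚ) (p : Fin (suc k)) → Σℚ f ≡ f p + Σℚ (f ∘ punchIn p)
  Σℚ-punchIn f zero = refl
  Σℚ-punchIn {suc k} f (suc p) = trans (cong (f zero +_) (Σℚ-punchIn (f ∘ suc) p))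
                                       (left-comm (f zero) (f (suc p)) _)
    where
    left-comm : ∀ a b c → a + (b + c) ≡ b + (a + c)
    left-comm = solve-∀ ℚ-ring

  Σℚ-single : ∀ {k} (f : Fin k → ℚ) (p : Fin k) → (∀ i → i ≢ p → f i ≡ 0ℚ) → Σℚ f ≡ f p
  Σℚ-single {suc k} f p others = begin
    Σℚ f                    ≡⟨ Σℚ-punchIn f p ⟩
    f p + Σℚ (f ∘ punchIn p) ≡⟨ cong (f p +_) (Σℚ-zero (λ i → others _ (Fin.punchInᵢ≢i p i))) ⟩
    f p + 0ℚ                ≡⟨ +-identityʳ (f p) ⟩
    f p                     ∎

  Σℚ-++ : ∀ {m n} (f : Fin (m ℕ.+ n) → ℚ) → Σℚ f ≡ Σℚ (λ i → f (i ↑ˡ n)) + Σℚ (λ j → f (m ↑ʳ j))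
  Σℚ-++ {zero}  f = sym (+-identityˡ _)
  Σℚ-++ {suc m} f = trans (cong (f zero +_) (Σℚ-++ {m} (f ∘ suc))) (sym (+-assoc (f zero) _ _))

  Σℚ-mono-≤ : ∀ {k} {f g : Fin k → ℚ} → (∀ i → f i ≤ g i) → Σℚ f ≤ Σℚ g
  Σℚ-mono-≤ {zero}  le = ≤-refl
  Σℚ-mono-≤ {suc k} le = +-mono-≤ (le zero) (Σℚ-mono-≤ (le ∘ suc))

  Σℚ-nonNeg : ∀ {k} {f : Fin k → ℚ} → (∀ i → 0ℚ ≤ f i) → 0ℚ ≤ Σℚ f
  Σℚ-nonNeg {k} nonNeg = ≤-trans (≤-reflexive (sym (Σℚ-zero {k} {λ _ → 0ℚ} (λ _ → refl)))) (Σℚ-mono-≤ nonNeg)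

  Σℚ-nonNeg-≡0 : ∀ {k} {f : Fin k → ℚ} → (∀ i → 0ℚ ≤ f i) → Σℚ f ≡ 0ℚ → ∀ i → f i ≡ 0ℚ
  Σℚ-nonNeg-≡0 {suc k} {f} nonNeg sum≡0 zero =
    nonNeg+nonNeg≡0⇒≡0 (nonNeg zero) (Σℚ-nonNeg (nonNeg ∘ suc)) sum≡0
  Σℚ-nonNeg-≡0 {suc k} {f} nonNeg sum≡0 (suc i) = Σℚ-nonNeg-≡0 (nonNeg ∘ suc)
    (nonNeg+nonNeg≡0⇒≡0 (Σℚ-nonNeg (nonNeg ∘ suc)) (nonNeg zero) (trans (+-comm _ (f zero)) sum≡0)) i

module LinearAlgebra where

  open Rationals
  open Sums
  open import Data.Rational.Properties
  open import Tactic.RingSolver using (solve-∀)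
  open import Data.Vec.Functional using (insertAt; _∷_)
  open import Data.Vec.Functional.Properties using (insertAt-lookup; insertAt-punchIn)
  open import Relation.Nullary using (¬?)
  open ≡-Reasoning

  private variable
    n k m : ℕ

  e-diag : (v : Fin n) → e v v ≡ 1ℚ
  e-diag v with v Fin.≟ v
  ... | yes _  = refl
  ... | no v≢v = contradiction refl v≢v

  e-offDiag : (v u : Fin n) → v ≢ u → e v u ≡ 0ℚ
  e-offDiag v u v≢u with v Fin.≟ u
  ... | yes v≡u = contradiction v≡u v≢u
  ... | no _    = refl

  one : Vecℚ n
  one _ = 1ℚ

  ⟨⟩-cong : (h : Vecℚ n) {x y : Vecℚ n} → (∀ u → x u ≡ y u) → ⟨ h , x ⟩ ≡ ⟨ h , y ⟩
  ⟨⟩-cong h x≗y = Σℚ-cong (λ u → cong (h u *_) (x≗y u))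

  ⟨⟩-zeroʳ : (h y : Vecℚ n) → (∀ u → y u ≡ 0ℚ) → ⟨ h , y ⟩ ≡ 0ℚ
  ⟨⟩-zeroʳ h y y≗0 = Σℚ-zero (λ u → trans (cong (h u *_) (y≗0 u)) (*-zeroʳ (h u)))

  ⟨⟩-e : (h : Vecℚ n) (v : Fin n) → ⟨ h , e v ⟩ ≡ h v
  ⟨⟩-e h v = begin
    ⟨ h , e v ⟩  ≡⟨ Σℚ-single (λ u → h u * e v u) v off-diagonal ⟩
    h v * e v v ≡⟨ cong (h v *_) (e-diag v) ⟩
    h v * 1ℚ    ≡⟨ *-identityʳ (h v) ⟩
    h v         ∎
    where
    off-diagonal : ∀ u → u ≢ v → h u * e v u ≡ 0ℚ
    off-diagonal u u≢v = trans (cong (h u *_) (e-offDiag v u (u≢v ∘ sym))) (*-zeroʳ (h u))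

  ⟨⟩-- : (h x y : Vecℚ n) → ⟨ h , x -ᵛ y ⟩ ≡ ⟨ h , x ⟩ - ⟨ h , y ⟩
  ⟨⟩-- h x y = trans (Σℚ-cong (λ u → *-distribˡ-- (h u) (x u) (y u)))
                     (Σℚ-- (λ u → h u * x u) (λ u → h u * y u))
    where
    *-distribˡ-- : ∀ a b c → a * (b - c) ≡ a * b - a * c
    *-distribˡ-- = solve-∀ ℚ-ring

  ⟨⟩-edge : (h : Vecℚ n) (v w : Fin n) → ⟨ h , e v -ᵛ e w ⟩ ≡ h v - h w
  ⟨⟩-edge h v w = trans (⟨⟩-- h (e v) (e w)) (cong₂ _-_ (⟨⟩-e h v) (⟨⟩-e h w))

  ⟨⟩-lincomb : (h : Vecℚ n) (c : Fin k → ℚ) (p : Fin k → Vecℚ n) →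
               ⟨ h , lincomb c p ⟩ ≡ Σℚ (λ i → c i * ⟨ h , p i ⟩)
  ⟨⟩-lincomb h c p = begin
    Σℚ (λ u → h u * Σℚ (λ i → c i * p i u))
      ≡⟨ Σℚ-cong (λ u → Σℚ-*ˡ (h u) (λ i → c i * p i u)) ⟨
    Σℚ (λ u → Σℚ (λ i → h u * (c i * p i u)))
      ≡⟨ Σℚ-swap (λ u i → h u * (c i * p i u)) ⟩
    Σℚ (λ i → Σℚ (λ u → h u * (c i * p i u)))
      ≡⟨ Σℚ-cong (λ i → trans (Σℚ-cong (left-comm′ i)) (Σℚ-*ˡ (c i) (λ u → h u * p i u))) ⟩
    Σℚ (λ i → c i * ⟨ h , p i ⟩)
      ∎
    where
    left-comm : ∀ a b c → a * (b * c) ≡ b * (a * c)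
    left-comm = solve-∀ ℚ-ring
    left-comm′ : ∀ i u → h u * (c i * p i u) ≡ c i * (h u * p i u)
    left-comm′ i u = left-comm (h u) (c i) (p i u)

  ⟨⟩-punchIn : (h y : Vecℚ (suc n)) (u₀ : Fin (suc n)) →
               ⟨ h , y ⟩ ≡ h u₀ * y u₀ + ⟨ h ∘ punchIn u₀ , y ∘ punchIn u₀ ⟩
  ⟨⟩-punchIn h y u₀ = Σℚ-punchIn (λ u → h u * y u) u₀

  ⟨⟩-affine : (h h′ x : Vecℚ n) (t β : ℚ) → (∀ u → h u ≡ t + β * h′ u) → ⟨ one , x ⟩ ≡ 0ℚ →
              ⟨ h , x ⟩ ≡ β * ⟨ h′ , x ⟩
  ⟨⟩-affine h h′ x t β h≗ Σx≡0 = begin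
    Σℚ (λ u → h u * x u)
      ≡⟨ Σℚ-cong (λ u → trans (cong (_* x u) (h≗ u)) (expand t β (h′ u) (x u))) ⟩
    Σℚ (λ u → t * (1ℚ * x u) + β * (h′ u * x u))
      ≡⟨ Σℚ-+ (λ u → t * (1ℚ * x u)) (λ u → β * (h′ u * x u)) ⟩
    Σℚ (λ u → t * (1ℚ * x u)) + Σℚ (λ u → β * (h′ u * x u))
      ≡⟨ cong₂ _+_ (Σℚ-*ˡ t (λ u → 1ℚ * x u)) (Σℚ-*ˡ β (λ u → h′ u * x u)) ⟩
    t * ⟨ one , x ⟩ + β * ⟨ h′ , x ⟩
      ≡⟨ cong (λ s → t * s + β * ⟨ h′ , x ⟩) Σx≡0 ⟩
    t * 0ℚ + β * ⟨ h′ , x ⟩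
      ≡⟨ drop t (β * ⟨ h′ , x ⟩) ⟩
    β * ⟨ h′ , x ⟩
      ∎
    where
    expand : ∀ t β y x → (t + β * y) * x ≡ t * (1ℚ * x) + β * (y * x)
    expand = solve-∀ ℚ-ring
    drop : ∀ t y → t * 0ℚ + y ≡ y
    drop = solve-∀ ℚ-ring

  vanish-punchIn : (y : Vecℚ (suc n)) (u₀ : Fin (suc n)) → y u₀ ≡ 0ℚ →
                   (∀ j → y (punchIn u₀ j) ≡ 0ℚ) → ∀ u → y u ≡ 0ℚ
  vanish-punchIn y u₀ y₀ y∘punchIn u with u₀ Fin.≟ u
  ... | yes refl = y₀
  ... | no u₀≢u  = trans (cong y (sym (Fin.punchIn-punchOut u₀≢u))) (y∘punchIn _)

  IsRelation : (Fin k → ℚ) → (Fin k → Vecℚ n) → Set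
  IsRelation c p = ∀ u → lincomb c p u ≡ 0ℚ

  NontrivialRelation : (Fin k → Vecℚ n) → Set
  NontrivialRelation p = Σ (Fin _ → ℚ) λ c → IsRelation c p × ∃ λ i → c i ≢ 0ℚ

  private
    lincomb-eliminate : (d : Fin k → ℚ) (α z : ℚ) (x y : Fin k → ℚ) →
      Σℚ (λ j → d j * (α * x j - y j * z)) ≡ α * Σℚ (λ j → d j * x j) - Σℚ (λ j → d j * y j) * z
    lincomb-eliminate d α z x y = begin
      Σℚ (λ j → d j * (α * x j - y j * z))              ≡⟨ Σℚ-cong (λ j → distrib (d j) α (x j) (y j) z) ⟩
      Σℚ (λ j → α * (d j * x j) - (d j * y j) * z)      ≡⟨ Σℚ-- (λ j → α * (d j * x j)) (λ j → (d j * y j) * z) ⟩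
      Σℚ (λ j → α * (d j * x j)) - Σℚ (λ j → (d j * y j) * z)
        ≡⟨ cong₂ _-_ (Σℚ-*ˡ α (λ j → d j * x j)) (Σℚ-*ʳ z (λ j → d j * y j)) ⟩
      α * Σℚ (λ j → d j * x j) - Σℚ (λ j → d j * y j) * z ∎
      where
      distrib : ∀ d α x y z → d * (α * x - y * z) ≡ α * (d * x) - (d * y) * z
      distrib = solve-∀ ℚ-ring

    -- Gaussian elimination on the pivot p i₀ zero ≠ 0: a relation d among the reduced
    -- vectors lifts to the relation (α d) with coefficient - Σ d_j p_j(0) inserted at i₀.
    dependent-pivot : (p : Fin (suc k) → Vecℚ (suc n)) (i₀ : Fin (suc k)) → p i₀ zero ≢ 0ℚ →
      NontrivialRelation (λ j u → p i₀ zero * p (punchIn i₀ j) (suc u) - p (punchIn i₀ j) zero * p i₀ (suc u)) →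
      NontrivialRelation p
    dependent-pivot p i₀ α≢0 (d , d-rel , j₀ , dj₀≢0) = c , c-rel , punchIn i₀ j₀ , cj₀≢0
      where
      α = p i₀ zero
      S : Vecℚ _
      S u = Σℚ (λ j → d j * p (punchIn i₀ j) u)
      c = insertAt (λ j → α * d j) i₀ (- S zero)
      expand : ∀ u → lincomb c p u ≡ α * S u - S zero * p i₀ u
      expand u = begin
        lincomb c p u
          ≡⟨ Σℚ-punchIn (λ i → c i * p i u) i₀ ⟩
        c i₀ * p i₀ u + Σℚ (λ j → c (punchIn i₀ j) * p (punchIn i₀ j) u)
          ≡⟨ cong₂ _+_ (cong (_* p i₀ u) (insertAt-lookup _ i₀ _))
                       (Σℚ-cong (λ j → trans (cong (_* p (punchIn i₀ j) u) (insertAt-punchIn _ i₀ _ j))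
                                             (*-assoc α (d j) _))) ⟩
        - S zero * p i₀ u + Σℚ (λ j → α * (d j * p (punchIn i₀ j) u))
          ≡⟨ cong (- S zero * p i₀ u +_) (Σℚ-*ˡ α (λ j → d j * p (punchIn i₀ j) u)) ⟩
        - S zero * p i₀ u + α * S u
          ≡⟨ rearrange (S zero) (p i₀ u) (α * S u) ⟩
        α * S u - S zero * p i₀ u ∎
        where
        rearrange : ∀ s x y → - s * x + y ≡ y - s * x
        rearrange = solve-∀ ℚ-ring
      c-rel : IsRelation c p
      c-rel zero    = trans (expand zero) (cancel α (S zero))
        where
        cancel : ∀ a s → a * s - s * a ≡ 0ℚ
        cancel = solve-∀ ℚ-ring
      c-rel (suc u) = trans (expand (suc u))
                            (trans (sym (lincomb-eliminate d α _ (λ j → p (punchIn i₀ j) (suc u)) _)) (d-rel u))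
      cj₀≢0 : c (punchIn i₀ j₀) ≢ 0ℚ
      cj₀≢0 cj₀≡0 = dj₀≢0 (p*q≡0⇒q≡0 α≢0 (trans (sym (insertAt-punchIn _ i₀ _ j₀)) cj₀≡0))

  dependent : n ℕ.< k → (p : Fin k → Vecℚ n) → NontrivialRelation p
  dependent {zero}  {suc k} _  p = (λ _ → 1ℚ) , (λ ()) , zero , 1≢0
  dependent {suc n} {suc k} n<k p with Fin.any? (λ i → ¬? (p i zero ≟ 0ℚ))
  ... | yes (i₀ , α≢0) = dependent-pivot p i₀ α≢0 (dependent (ℕ.≤-pred n<k) _)
  ... | no no-pivot    = c , c-rel , nontrivial
    where
    tails = dependent (ℕ.<-trans (ℕ.n<1+n n) n<k) (λ i → p i ∘ suc)
    c = proj₁ tails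
    nontrivial = proj₂ (proj₂ tails)
    heads-zero : ∀ i → p i zero ≡ 0ℚ
    heads-zero i with p i zero ≟ 0ℚ
    ... | yes pi≡0 = pi≡0
    ... | no pi≢0  = contradiction (i , pi≢0) no-pivot
    c-rel : IsRelation c p
    c-rel zero    = Σℚ-zero (λ i → trans (cong (c i *_) (heads-zero i)) (*-zeroʳ (c i)))
    c-rel (suc u) = proj₁ (proj₂ tails) u

  isRelation-unpunch : (ℓ : Vecℚ (suc n)) (u₀ : Fin (suc n)) → ℓ u₀ ≡ 1ℚ →
    (p : Fin k → Vecℚ (suc n)) → (∀ i → ⟨ ℓ , p i ⟩ ≡ 0ℚ) →
    (c : Fin k → ℚ) → IsRelation c (λ i → p i ∘ punchIn u₀) → IsRelation c p
  isRelation-unpunch ℓ u₀ ℓu₀≡1 p ℓ⊥p c rel = vanish-punchIn y u₀ y₀ rel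
    where
    y = lincomb c p
    y₀ : y u₀ ≡ 0ℚ
    y₀ = begin
      y u₀                                              ≡⟨ *-identityˡ (y u₀) ⟨
      1ℚ * y u₀                                         ≡⟨ cong (_* y u₀) ℓu₀≡1 ⟨
      ℓ u₀ * y u₀                                       ≡⟨ +-identityʳ _ ⟨
      ℓ u₀ * y u₀ + 0ℚ                                  ≡⟨ cong (ℓ u₀ * y u₀ +_) y∘punchIn⊥ ⟨
      ℓ u₀ * y u₀ + ⟨ ℓ ∘ punchIn u₀ , y ∘ punchIn u₀ ⟩ ≡⟨ ⟨⟩-punchIn ℓ y u₀ ⟨
      ⟨ ℓ , y ⟩                                         ≡⟨ ⟨⟩-lincomb ℓ c p ⟩
      Σℚ (λ i → c i * ⟨ ℓ , p i ⟩)                      ≡⟨ Σℚ-zero terms≡0 ⟩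
      0ℚ                                                ∎
      where
      terms≡0 : ∀ i → c i * ⟨ ℓ , p i ⟩ ≡ 0ℚ
      terms≡0 i = trans (cong (c i *_) (ℓ⊥p i)) (*-zeroʳ (c i))
      y∘punchIn⊥ : ⟨ ℓ ∘ punchIn u₀ , y ∘ punchIn u₀ ⟩ ≡ 0ℚ
      y∘punchIn⊥ = ⟨⟩-zeroʳ (ℓ ∘ punchIn u₀) (y ∘ punchIn u₀) rel

  dependent-⊥₁ : (ℓ : Vecℚ n) (u₀ : Fin n) → ℓ u₀ ≡ 1ℚ → n ℕ.≤ k →
    (p : Fin k → Vecℚ n) → (∀ i → ⟨ ℓ , p i ⟩ ≡ 0ℚ) → NontrivialRelation p
  dependent-⊥₁ {suc n} ℓ u₀ ℓu₀≡1 n<k p ℓ⊥p with dependent n<k (λ i → p i ∘ punchIn u₀)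
  ... | c , rel , nontrivial = c , isRelation-unpunch ℓ u₀ ℓu₀≡1 p ℓ⊥p c rel , nontrivial

  -- The echelon shape of (ℓ₁, ℓ₂) at (u₀, u₁) makes them independent; eliminate u₀, then u₁.
  dependent-⊥₂ : (ℓ₁ ℓ₂ : Vecℚ n) (u₀ u₁ : Fin n) → ℓ₁ u₀ ≡ 1ℚ → ℓ₂ u₀ ≡ 0ℚ → ℓ₂ u₁ ≡ 1ℚ →
    n ℕ.≤ suc k → (p : Fin k → Vecℚ n) → (∀ i → ⟨ ℓ₁ , p i ⟩ ≡ 0ℚ) → (∀ i → ⟨ ℓ₂ , p i ⟩ ≡ 0ℚ) →
    NontrivialRelation p
  dependent-⊥₂ {suc n} ℓ₁ ℓ₂ u₀ u₁ ℓ₁u₀≡1 ℓ₂u₀≡0 ℓ₂u₁≡1 (s≤s n≤k) p ℓ₁⊥p ℓ₂⊥p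
    with dependent-⊥₁ (ℓ₂ ∘ punchIn u₀) (punchOut u₀≢u₁) ℓ₂u₁≡1′ n≤k (λ i → p i ∘ punchIn u₀) ℓ₂⊥p′
    where
    u₀≢u₁ : u₀ ≢ u₁
    u₀≢u₁ refl = 1≢0 (trans (sym ℓ₂u₁≡1) ℓ₂u₀≡0)
    ℓ₂u₁≡1′ : ℓ₂ (punchIn u₀ (punchOut u₀≢u₁)) ≡ 1ℚ
    ℓ₂u₁≡1′ = trans (cong ℓ₂ (Fin.punchIn-punchOut u₀≢u₁)) ℓ₂u₁≡1
    ℓ₂⊥p′ : ∀ i → ⟨ ℓ₂ ∘ punchIn u₀ , p i ∘ punchIn u₀ ⟩ ≡ 0ℚ
    ℓ₂⊥p′ i = begin
      R                        ≡⟨ +-identityˡ R ⟨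
      0ℚ + R                   ≡⟨ cong (_+ R) (trans (sym (*-zeroˡ (p i u₀))) (cong (_* p i u₀) (sym ℓ₂u₀≡0))) ⟩
      ℓ₂ u₀ * p i u₀ + R       ≡⟨ ⟨⟩-punchIn ℓ₂ (p i) u₀ ⟨
      ⟨ ℓ₂ , p i ⟩             ≡⟨ ℓ₂⊥p i ⟩
      0ℚ                       ∎
      where R = ⟨ ℓ₂ ∘ punchIn u₀ , p i ∘ punchIn u₀ ⟩
  ... | c , rel , nontrivial = c , isRelation-unpunch ℓ₁ u₀ ℓ₁u₀≡1 p ℓ₁⊥p c rel , nontrivial

  OnHyperplane : (Vecℚ n → Set) → Vecℚ n → ℚ → Set
  OnHyperplane S h β = ∀ x → S x → ⟨ h , x ⟩ ≡ β

  -- Points on a hyperplane missing the origin: a linear relation is automatically affine.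
  AffIndep⇒¬NontrivialRelation : (h : Vecℚ n) (β : ℚ) → β ≢ 0ℚ → (p : Fin k → Vecℚ n) →
    (∀ i → ⟨ h , p i ⟩ ≡ β) → AffIndep p → ¬ NontrivialRelation p
  AffIndep⇒¬NontrivialRelation h β β≢0 p hp≡β indep (c , rel , i , ci≢0) = ci≢0 (indep c Σc≡0 rel i)
    where
    Σc≡0 : Σℚ c ≡ 0ℚ
    Σc≡0 = p*q≡0⇒q≡0 β≢0 (begin
      β * Σℚ c                       ≡⟨ *-comm β (Σℚ c) ⟩
      Σℚ c * β                       ≡⟨ Σℚ-*ʳ β c ⟨
      Σℚ (λ i → c i * β)             ≡⟨ Σℚ-cong (λ i → cong (c i *_) (hp≡β i)) ⟨
      Σℚ (λ i → c i * ⟨ h , p i ⟩)   ≡⟨ ⟨⟩-lincomb h c p ⟨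
      ⟨ h , lincomb c p ⟩            ≡⟨ ⟨⟩-zeroʳ h (lincomb c p) rel ⟩
      0ℚ                             ∎)

  AffIndep⇒differences-¬NontrivialRelation : (p : Fin (suc k) → Vecℚ n) → AffIndep p →
    ¬ NontrivialRelation (λ i → p (suc i) -ᵛ p zero)
  AffIndep⇒differences-¬NontrivialRelation {k} p indep (d , rel , i , di≢0) = di≢0 (indep c Σc≡0 c-rel (suc i))
    where
    c : Fin (suc k) → ℚ
    c zero    = - Σℚ d
    c (suc i) = d i
    Σc≡0 : Σℚ c ≡ 0ℚ
    Σc≡0 = +-inverseˡ (Σℚ d)
    c-rel : IsRelation c p
    c-rel u = begin
      - Σℚ d * p zero u + Σ⁺           ≡⟨ rearrange (Σℚ d) (p zero u) Σ⁺ ⟩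
      Σ⁺ - Σℚ d * p zero u             ≡⟨ cong (λ s → Σ⁺ - s) (Σℚ-*ʳ (p zero u) d) ⟨
      Σ⁺ - Σℚ (λ i → d i * p zero u)   ≡⟨ Σℚ-- (λ i → d i * p (suc i) u) (λ i → d i * p zero u) ⟨
      Σℚ (λ i → d i * p (suc i) u - d i * p zero u)
                                       ≡⟨ Σℚ-cong (λ i → factor (d i) (p (suc i) u) (p zero u)) ⟩
      lincomb d (λ i → p (suc i) -ᵛ p zero) u
                                       ≡⟨ rel u ⟩
      0ℚ                               ∎
      where
      Σ⁺ = Σℚ (λ i → d i * p (suc i) u)
      rearrange : ∀ s z y → - s * z + y ≡ y - s * z
      rearrange = solve-∀ ℚ-ring
      factor : ∀ a x z → a * x - a * z ≡ a * (x - z)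
      factor = solve-∀ ℚ-ring

  ¬HasAffIndep-⊥₁ : (S : Vecℚ n → Set) (ℓ : Vecℚ n) (u₀ : Fin n) → ℓ u₀ ≡ 1ℚ → OnHyperplane S ℓ 0ℚ →
    (h : Vecℚ n) (β : ℚ) → β ≢ 0ℚ → OnHyperplane S h β → n ℕ.≤ k → ¬ HasAffIndep S k
  ¬HasAffIndep-⊥₁ S ℓ u₀ ℓu₀≡1 S⊥ℓ h β β≢0 S⊆h n≤k (p , p∈S , indep) =
    AffIndep⇒¬NontrivialRelation h β β≢0 p (λ i → S⊆h _ (p∈S i)) indep
      (dependent-⊥₁ ℓ u₀ ℓu₀≡1 n≤k p (λ i → S⊥ℓ _ (p∈S i)))

  ¬HasAffIndep-⊥₂ : (S : Vecℚ n → Set) (ℓ₁ ℓ₂ : Vecℚ n) (u₀ u₁ : Fin n) →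
    ℓ₁ u₀ ≡ 1ℚ → ℓ₂ u₀ ≡ 0ℚ → ℓ₂ u₁ ≡ 1ℚ → OnHyperplane S ℓ₁ 0ℚ → OnHyperplane S ℓ₂ 0ℚ →
    (h : Vecℚ n) (β : ℚ) → β ≢ 0ℚ → OnHyperplane S h β → n ℕ.≤ suc k → ¬ HasAffIndep S k
  ¬HasAffIndep-⊥₂ S ℓ₁ ℓ₂ u₀ u₁ ℓ₁u₀ ℓ₂u₀ ℓ₂u₁ S⊥ℓ₁ S⊥ℓ₂ h β β≢0 S⊆h n≤k (p , p∈S , indep) =
    AffIndep⇒¬NontrivialRelation h β β≢0 p (λ i → S⊆h _ (p∈S i)) indep
      (dependent-⊥₂ ℓ₁ ℓ₂ u₀ u₁ ℓ₁u₀ ℓ₂u₀ ℓ₂u₁ n≤k p (λ i → S⊥ℓ₁ _ (p∈S i)) (λ i → S⊥ℓ₂ _ (p∈S i)))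

  ¬HasAffIndep-⊥ : (S : Vecℚ n → Set) (ℓ : Vecℚ n) (u₀ : Fin n) → ℓ u₀ ≡ 1ℚ → OnHyperplane S ℓ 0ℚ →
    n ℕ.≤ k → ¬ HasAffIndep S (suc k)
  ¬HasAffIndep-⊥ S ℓ u₀ ℓu₀≡1 S⊥ℓ n≤k (p , p∈S , indep) =
    AffIndep⇒differences-¬NontrivialRelation p indep
      (dependent-⊥₁ ℓ u₀ ℓu₀≡1 n≤k (λ i → p (suc i) -ᵛ p zero) ℓ⊥differences)
    where
    ℓ⊥differences : ∀ i → ⟨ ℓ , p (suc i) -ᵛ p zero ⟩ ≡ 0ℚ
    ℓ⊥differences i = trans (⟨⟩-- ℓ (p (suc i)) (p zero))
      (trans (cong₂ _-_ (S⊥ℓ _ (p∈S (suc i))) (S⊥ℓ _ (p∈S zero))) (+-inverseʳ 0ℚ))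

  HasAffIndep-drop : {S : Vecℚ n → Set} → HasAffIndep S (suc m) → HasAffIndep S m
  HasAffIndep-drop {m = m} (p , p∈S , indep) = p ∘ suc , p∈S ∘ suc , indep′
    where
    indep′ : AffIndep (p ∘ suc)
    indep′ c Σc≡0 rel i = indep c′ (trans (+-identityˡ (Σℚ c)) Σc≡0) rel′ (suc i)
      where
      c′ : Fin (suc m) → ℚ
      c′ zero    = 0ℚ
      c′ (suc i) = c i
      rel′ : IsRelation c′ p
      rel′ u = trans (cong (_+ lincomb c (p ∘ suc) u) (*-zeroˡ (p zero u))) (trans (+-identityˡ _) (rel u))

  HasAffIndep-mono : {S : Vecℚ n → Set} {m′ : ℕ} → m′ ℕ.≤ m → HasAffIndep S m → HasAffIndep S m′
  HasAffIndep-mono {S = S} m′≤m H with ℕ.m≤n⇒m<n∨m≡n m′≤m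
  ... | inj₂ refl       = H
  ... | inj₁ (s≤s m′≤m) = HasAffIndep-mono {S = S} m′≤m (HasAffIndep-drop {S = S} H)

  HasAffIndep-bound : {S : Vecℚ n → Set} {m k : ℕ} → ¬ HasAffIndep S (suc m) → HasAffIndep S k → k ℕ.≤ m
  HasAffIndep-bound {S = S} {m} {k} ¬H H with k ℕ.≤? m
  ... | yes k≤m = k≤m
  ... | no k≰m  = contradiction (HasAffIndep-mono {S = S} (ℕ.≰⇒> k≰m) H) ¬H


  Σℚ-δ : {ι : Fin k → Fin n} → (∀ {j j′} → ι j ≡ ι j′ → j ≡ j′) → (f : Fin k → ℚ) (j₀ : Fin k) →
         Σℚ (λ j → f j * e (ι j) (ι j₀)) ≡ f j₀
  Σℚ-δ {ι = ι} ι-injective f j₀ = begin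
    Σℚ (λ j → f j * e (ι j) (ι j₀))  ≡⟨ Σℚ-single (λ j → f j * e (ι j) (ι j₀)) j₀ off-diagonal ⟩
    f j₀ * e (ι j₀) (ι j₀)           ≡⟨ cong (f j₀ *_) (e-diag (ι j₀)) ⟩
    f j₀ * 1ℚ                        ≡⟨ *-identityʳ (f j₀) ⟩
    f j₀                             ∎
    where
    off-diagonal : ∀ j → j ≢ j₀ → f j * e (ι j) (ι j₀) ≡ 0ℚ
    off-diagonal j j≢j₀ = trans (cong (f j *_) (e-offDiag (ι j) (ι j₀) (j≢j₀ ∘ ι-injective))) (*-zeroʳ (f j))

  LinIndep : (Fin k → Vecℚ n) → Set
  LinIndep p = ∀ c → IsRelation c p → ∀ i → c i ≡ 0ℚ

  LinIndep⇒AffIndep : {p : Fin k → Vecℚ n} → LinIndep p → AffIndep p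
  LinIndep⇒AffIndep indep c _ = indep c

  LinIndep-scale : {p q : Fin k → Vecℚ n} (s : Fin k → ℚ) → (∀ i → s i ≢ 0ℚ) →
                   (∀ i u → q i u ≡ s i * p i u) → LinIndep p → LinIndep q
  LinIndep-scale {p = p} {q} s s≢0 q≗sp indep c rel i =
    p*q≡0⇒q≡0 (s≢0 i) (trans (*-comm (s i) (c i)) (indep (λ i → c i * s i) rel′ i))
    where
    rel′ : IsRelation (λ i → c i * s i) p
    rel′ u = trans (Σℚ-cong (λ i → trans (*-assoc (c i) (s i) (p i u)) (cong (c i *_) (sym (q≗sp i u))))) (rel u)

  AffIndep-0∷ : {p : Fin k → Vecℚ n} → LinIndep p → AffIndep ((λ _ → 0ℚ) ∷ p)
  AffIndep-0∷ {k} {p = p} indep c Σc≡0 rel = c≡0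
    where
    tail-rel : IsRelation (c ∘ suc) p
    tail-rel u = trans (sym (trans (cong (_+ lincomb (c ∘ suc) p u) (*-zeroʳ (c zero))) (+-identityˡ _))) (rel u)
    c≡0 : ∀ i → c i ≡ 0ℚ
    c≡0 zero    = begin
      c zero                  ≡⟨ +-identityʳ (c zero) ⟨
      c zero + 0ℚ             ≡⟨ cong (c zero +_) (Σℚ-zero (indep (c ∘ suc) tail-rel)) ⟨
      c zero + Σℚ (c ∘ suc)   ≡⟨ Σc≡0 ⟩
      0ℚ                      ∎
    c≡0 (suc i) = indep (c ∘ suc) tail-rel i

module EdgePolytope {n : ℕ} (G : Graph n) where

  open Rationals
  open Sums
  open LinearAlgebra
  open import Data.Rational.Properties
  open import Data.Rational using (½)
  open import Data.Sum using (swap)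
  open import Data.Vec.Functional using (_∷_; [])
  open import Tactic.RingSolver using (solve-∀)

  generator-∈P : ∀ g → Generator G g → P G g
  generator-∈P g g-gen = 1 , (λ _ → 1ℚ) , (λ _ → g) , (λ _ → 0≤1) , +-identityʳ 1ℚ , (λ _ → g-gen) ,
                         λ u → sym (trans (+-identityʳ (1ℚ * g u)) (*-identityˡ (g u)))

  0∈P : ∀ {v w} → G v w → P G (λ _ → 0ℚ)
  0∈P {v} {w} vw = 2 , (λ _ → ½) , p , (λ _ → 0≤½) , refl , p-gen , λ u → sym (cancel (e v u) (e w u))
    where
    p : Fin 2 → Vecℚ n
    p = (e v -ᵛ e w) ∷ (e w -ᵛ e v) ∷ []
    p-gen : ∀ i → Generator G (p i)
    p-gen zero       = v , w , inj₁ vw , refl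
    p-gen (suc zero) = w , v , inj₂ vw , refl
    cancel : ∀ x y → ½ * (x - y) + (½ * (y - x) + 0ℚ) ≡ 0ℚ
    cancel = solve-∀ ℚ-ring

  ⟨⟩-∈P : (h : Vecℚ n) {x : Vecℚ n} ((k , c , p , _) : P G x) → ⟨ h , x ⟩ ≡ Σℚ (λ i → c i * ⟨ h , p i ⟩)
  ⟨⟩-∈P h {x} (k , c , p , _ , _ , _ , x≗) = trans (⟨⟩-cong h x≗) (⟨⟩-lincomb h c p)

  P⊥ : (ℓ : Vecℚ n) → (∀ g → Generator G g → ⟨ ℓ , g ⟩ ≡ 0ℚ) → OnHyperplane (P G) ℓ 0ℚ
  P⊥ ℓ ℓ⊥gen x x∈P@(k , c , p , _ , _ , p-gen , _) =
    trans (⟨⟩-∈P ℓ x∈P) (Σℚ-zero (λ i → trans (cong (c i *_) (ℓ⊥gen (p i) (p-gen i))) (*-zeroʳ (c i))))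

  P⊥one : OnHyperplane (P G) one 0ℚ
  P⊥one = P⊥ one one⊥gen
    where
    one⊥gen : ∀ g → Generator G g → ⟨ one , g ⟩ ≡ 0ℚ
    one⊥gen g (v , w , _ , refl) = trans (⟨⟩-edge one v w) (+-inverseʳ 1ℚ)

  valid-fromGenerators : (h : Vecℚ n) (β : ℚ) → (∀ g → Generator G g → ⟨ h , g ⟩ ≤ β) → Valid (P G) h β
  valid-fromGenerators h β gen≤β x x∈P@(k , c , p , c≥0 , Σc≡1 , p-gen , _) = begin
    ⟨ h , x ⟩                      ≡⟨ ⟨⟩-∈P h x∈P ⟩
    Σℚ (λ i → c i * ⟨ h , p i ⟩)   ≤⟨ Σℚ-mono-≤ (λ i → *-monoˡ-≤-nonNeg′ (c≥0 i) (gen≤β (p i) (p-gen i))) ⟩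
    Σℚ (λ i → c i * β)             ≡⟨ Σℚ-*ʳ β c ⟩
    Σℚ c * β                       ≡⟨ cong (_* β) Σc≡1 ⟩
    1ℚ * β                         ≡⟨ *-identityˡ β ⟩
    β                              ∎
    where open ≤-Reasoning

  Valid-0⇒⊥ : (h : Vecℚ n) → Valid (P G) h 0ℚ → OnHyperplane (P G) h 0ℚ
  Valid-0⇒⊥ h valid = P⊥ h h⊥gen
    where
    ≤-along : ∀ x y → G x y ⊎ G y x → h x ≤ h y
    ≤-along x y xy = p-q≤0⇒p≤q (≤-trans (≤-reflexive (sym (⟨⟩-edge h x y)))
                                        (valid _ (generator-∈P _ (x , y , xy , refl))))
    h⊥gen : ∀ g → Generator G g → ⟨ h , g ⟩ ≡ 0ℚ
    h⊥gen g (v , w , vw , refl) = begin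
      ⟨ h , e v -ᵛ e w ⟩  ≡⟨ ⟨⟩-edge h v w ⟩
      h v - h w          ≡⟨ cong (_- h w) (≤-antisym (≤-along v w vw) (≤-along w v (swap vw))) ⟩
      h w - h w          ≡⟨ +-inverseʳ (h w) ⟩
      0ℚ                 ∎
      where open ≡-Reasoning

  -- The slacks c i (β - ⟨ h , p i ⟩) are nonnegative and sum to β - ⟨ h , x ⟩ = 0, so a point
  -- of the face only uses generators on which the inequality is tight.
  Face⊥ : (h ℓ : Vecℚ n) (β : ℚ) → (∀ g → Generator G g → ⟨ h , g ⟩ ≤ β) →
          (∀ g → Generator G g → ⟨ h , g ⟩ ≡ β → ⟨ ℓ , g ⟩ ≡ 0ℚ) → OnHyperplane (Face (P G) h β) ℓ 0ℚ
  Face⊥ h ℓ β gen≤β tight⊥ℓ x (x∈P@(k , c , p , c≥0 , Σc≡1 , p-gen , _) , hx≡β) =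
    trans (⟨⟩-∈P ℓ x∈P) (Σℚ-zero term≡0)
    where
    open ≡-Reasoning
    slack : Fin k → ℚ
    slack i = c i * (β - ⟨ h , p i ⟩)
    slack≥0 : ∀ i → 0ℚ ≤ slack i
    slack≥0 i = nonNeg*nonNeg (c≥0 i) (p≤q⇒0≤q-p (gen≤β (p i) (p-gen i)))
    Σslack≡0 : Σℚ slack ≡ 0ℚ
    Σslack≡0 = begin
      Σℚ slack
        ≡⟨ Σℚ-cong (λ i → distrib (c i) β ⟨ h , p i ⟩) ⟩
      Σℚ (λ i → c i * β - c i * ⟨ h , p i ⟩)
        ≡⟨ Σℚ-- (λ i → c i * β) (λ i → c i * ⟨ h , p i ⟩) ⟩
      Σℚ (λ i → c i * β) - Σℚ (λ i → c i * ⟨ h , p i ⟩)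
        ≡⟨ cong₂ _-_ (trans (Σℚ-*ʳ β c) (cong (_* β) Σc≡1)) (sym (⟨⟩-∈P h x∈P)) ⟩
      1ℚ * β - ⟨ h , x ⟩
        ≡⟨ cong (λ y → 1ℚ * β - y) hx≡β ⟩
      1ℚ * β - β
        ≡⟨ cancel β ⟩
      0ℚ
        ∎
      where
      distrib : ∀ c β a → c * (β - a) ≡ c * β - c * a
      distrib = solve-∀ ℚ-ring
      cancel : ∀ β → 1ℚ * β - β ≡ 0ℚ
      cancel = solve-∀ ℚ-ring
    term≡0 : ∀ i → c i * ⟨ ℓ , p i ⟩ ≡ 0ℚ
    term≡0 i with c i ≟ 0ℚ
    ... | yes ci≡0 = trans (cong (_* ⟨ ℓ , p i ⟩) ci≡0) (*-zeroˡ ⟨ ℓ , p i ⟩)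
    ... | no ci≢0  = trans (cong (c i *_) (tight⊥ℓ (p i) (p-gen i) tight)) (*-zeroʳ (c i))
      where
      tight : ⟨ h , p i ⟩ ≡ β
      tight = sym (p-q≡0⇒p≡q (p*q≡0⇒q≡0 ci≢0 (Σℚ-nonNeg-≡0 slack≥0 Σslack≡0 i)))

  Face-affine : (h h′ : Vecℚ n) (t β : ℚ) → β ≢ 0ℚ → (∀ u → h u ≡ t + β * h′ u) →
                SameSet (Face (P G) h β) (Face (P G) h′ 1ℚ)
  Face-affine h h′ t β β≢0 h≗ x = to , from
    where
    open ≡-Reasoning
    h≡βh′ : P G x → ⟨ h , x ⟩ ≡ β * ⟨ h′ , x ⟩
    h≡βh′ x∈P = ⟨⟩-affine h h′ x t β h≗ (P⊥one x x∈P)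
    to : Face (P G) h β x → Face (P G) h′ 1ℚ x
    to (x∈P , hx≡β) = x∈P , sym (p-q≡0⇒p≡q (p*q≡0⇒q≡0 β≢0 (begin
      β * (1ℚ - ⟨ h′ , x ⟩)      ≡⟨ distrib β ⟨ h′ , x ⟩ ⟩
      β - β * ⟨ h′ , x ⟩         ≡⟨ cong (λ y → β - y) (trans (sym (h≡βh′ x∈P)) hx≡β) ⟩
      β - β                      ≡⟨ +-inverseʳ β ⟩
      0ℚ                         ∎)))
      where
      distrib : ∀ β y → β * (1ℚ - y) ≡ β - β * y
      distrib = solve-∀ ℚ-ring
    from : Face (P G) h′ 1ℚ x → Face (P G) h β x
    from (x∈P , h′x≡1) = x∈P , trans (h≡βh′ x∈P) (trans (cong (β *_) h′x≡1) (*-identityʳ β))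

  -- For β = 0 the face would be all of P G.
  DefinesFacet⇒≢0 : (h : Vecℚ n) (β : ℚ) → DefinesFacet (P G) h β → β ≢ 0ℚ
  DefinesFacet⇒≢0 h β (valid , d , ((p , p∈P , indep) , _) , (_ , ¬face-indep)) refl =
    ¬face-indep (p , (λ i → p∈P i , Valid-0⇒⊥ h valid (p i) (p∈P i)) , indep)

module FacetCounting where

  open import Function.Bundles using (_↔_; Inverse)

  private variable
    n : ℕ
    A B C : Vecℚ n → Set

  SameSet-sym : SameSet A B → SameSet B A
  SameSet-sym A≐B x = proj₂ (A≐B x) , proj₁ (A≐B x)

  SameSet-trans : SameSet A B → SameSet B C → SameSet A C
  SameSet-trans A≐B B≐C x = proj₁ (B≐C x) ∘ proj₁ (A≐B x) , proj₂ (A≐B x) ∘ proj₂ (B≐C x)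

  HasNFacets-from : {Q : Vecℚ n → Set} {I : Set} {N : ℕ} → Fin N ↔ I → (F : I → Vecℚ n → Set) →
    (∀ ι → IsFacet Q (F ι)) → (∀ ι ι′ → SameSet (F ι) (F ι′) → ι ≡ ι′) →
    (∀ G → IsFacet Q G → ∃ λ ι → SameSet G (F ι)) → HasNFacets Q N
  HasNFacets-from {Q = Q} enum F F-facet F-injective F-complete =
    F ∘ to , F-facet ∘ to , (λ k k′ same → to-injective (F-injective _ _ same)) , complete
    where
    open Inverse enum
    to-injective : ∀ {k k′} → to k ≡ to k′ → k ≡ k′
    to-injective {k} {k′} eq = trans (sym (strictlyInverseʳ k)) (trans (cong from eq) (strictlyInverseʳ k′))
    complete : ∀ G → IsFacet Q G → ∃ λ k → SameSet G (F (to k))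
    complete G G-facet with F-complete G G-facet
    ... | ι , G≐Fι = from ι , subst (λ ι′ → SameSet G (F ι′)) (sym (strictlyInverseˡ ι)) G≐Fι

module CompleteBipartite (a′ b′ : ℕ) where

  open Rationals
  open Sums
  open LinearAlgebra
  open FacetCounting using (SameSet-sym; SameSet-trans; HasNFacets-from)
  open import Data.Rational.Properties
  open import Tactic.RingSolver using (solve-∀)
  open import Data.Vec.Functional using (_∷_; _++_)
  open import Data.Vec.Functional.Properties using (lookup-++ˡ; lookup-++ʳ)
  open ≡-Reasoning

  a b : ℕ
  a = suc a′
  b = suc b′

  V : Fin a → Fin (a ℕ.+ b)
  V = vtx b

  W : Fin b → Fin (a ℕ.+ b)
  W = wtx a

  PK : Vecℚ (a ℕ.+ b) → Set
  PK = P (K a b)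

  open EdgePolytope (K a b)

  V≢W : ∀ i j → V i ≢ W j
  V≢W i j Vi≡Wj with trans (sym (Fin.splitAt-↑ˡ a i b)) (trans (cong (Fin.splitAt a) Vi≡Wj) (Fin.splitAt-↑ʳ a b j))
  ... | ()

  V-injective : ∀ {i i′} → V i ≡ V i′ → i ≡ i′
  V-injective = Fin.↑ˡ-injective b _ _

  W-injective : ∀ {j j′} → W j ≡ W j′ → j ≡ j′
  W-injective = Fin.↑ʳ-injective a _ _

  vertex-cases : ∀ u → (∃ λ i → V i ≡ u) ⊎ (∃ λ j → W j ≡ u)
  vertex-cases u with Fin.splitAt a u in eq
  ... | inj₁ i = inj₁ (i , Fin.splitAt⁻¹-↑ˡ eq)
  ... | inj₂ j = inj₂ (j , Fin.splitAt⁻¹-↑ʳ eq)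

  e-VW : ∀ i j → e (V i) (W j) ≡ 0ℚ
  e-VW i j = e-offDiag (V i) (W j) (V≢W i j)

  e-WV : ∀ i j → e (W j) (V i) ≡ 0ℚ
  e-WV i j = e-offDiag (W j) (V i) (V≢W i j ∘ sym)

  generator-VW : ∀ i j → Generator (K a b) (e (V i) -ᵛ e (W j))
  generator-VW i j = V i , W j , inj₁ (i , j , refl , refl) , refl

  generator-WV : ∀ i j → Generator (K a b) (e (W j) -ᵛ e (V i))
  generator-WV i j = W j , V i , inj₂ (i , j , refl , refl) , refl

  generator-cases : ∀ {g} → Generator (K a b) g →
    ∃ λ i → ∃ λ j → (g ≡ e (V i) -ᵛ e (W j)) ⊎ (g ≡ e (W j) -ᵛ e (V i))
  generator-cases (_ , _ , inj₁ (i , j , refl , refl) , refl) = i , j , inj₁ refl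
  generator-cases (_ , _ , inj₂ (i , j , refl , refl) , refl) = i , j , inj₂ refl

  EdgeBounds : Vecℚ (a ℕ.+ b) → ℚ → Set
  EdgeBounds h β = ∀ i j → h (V i) - h (W j) ≤ β × h (W j) - h (V i) ≤ β

  Valid⇒EdgeBounds : ∀ {h β} → Valid PK h β → EdgeBounds h β
  Valid⇒EdgeBounds {h} valid i j =
    ≤-trans (≤-reflexive (sym (⟨⟩-edge h (V i) (W j)))) (valid _ (generator-∈P _ (generator-VW i j))) ,
    ≤-trans (≤-reflexive (sym (⟨⟩-edge h (W j) (V i)))) (valid _ (generator-∈P _ (generator-WV i j)))

  EdgeBounds⇒generator-≤ : ∀ {h β} → EdgeBounds h β → ∀ g → Generator (K a b) g → ⟨ h , g ⟩ ≤ β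
  EdgeBounds⇒generator-≤ {h} bounds g g-gen with generator-cases g-gen
  ... | i , j , inj₁ refl = ≤-trans (≤-reflexive (⟨⟩-edge h (V i) (W j))) (proj₁ (bounds i j))
  ... | i , j , inj₂ refl = ≤-trans (≤-reflexive (⟨⟩-edge h (W j) (V i))) (proj₂ (bounds i j))

  -- The spanning tree of the edges v₀w_j and v_{i+1}w₀, listed over Fin (b + a′).
  treeV : Fin (b ℕ.+ a′) → Fin a
  treeV = (λ _ → zero) ++ suc

  treeW : Fin (b ℕ.+ a′) → Fin b
  treeW = (λ j → j) ++ (λ _ → zero)

  tree : Fin (b ℕ.+ a′) → Vecℚ (a ℕ.+ b)
  tree k = e (V (treeV k)) -ᵛ e (W (treeW k))

  -- A relation c among the tree edges, read off at the leaves v_{i+1} and w_j.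
  module TreeRelation (c : Fin (b ℕ.+ a′) → ℚ) (rel : IsRelation c tree) where

    cW : Fin b → ℚ
    cW j = c (j ↑ˡ a′)

    cV : Fin a′ → ℚ
    cV i = c (b ↑ʳ i)

    edgesAtV₀ edgesAtW₀ : Fin (a ℕ.+ b) → ℚ
    edgesAtV₀ u = Σℚ (λ j → cW j * (e (V zero) u - e (W j) u))
    edgesAtW₀ u = Σℚ (λ i → cV i * (e (V (suc i)) u - e (W zero) u))

    edgesAtV₀+edgesAtW₀≡0 : ∀ u → edgesAtV₀ u + edgesAtW₀ u ≡ 0ℚ
    edgesAtV₀+edgesAtW₀≡0 u = trans (sym (trans (Σℚ-++ {b} {a′} (λ k → c k * tree k u)) (cong₂ _+_
      (Σℚ-cong (λ j → cong₂ (λ i j′ → cW j * (e (V i) u - e (W j′) u))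
                             (lookup-++ˡ {n = a′} (λ _ → zero) suc j) (lookup-++ˡ {n = a′} (λ j → j) (λ _ → zero) j)))
      (Σℚ-cong (λ i → cong₂ (λ i′ j → cV i * (e (V i′) u - e (W j) u))
                             (lookup-++ʳ {m = b} (λ _ → zero) suc i) (lookup-++ʳ {m = b} (λ j → j) (λ _ → zero) i))))))
      (rel u)

    private
      x*[0-0] : ∀ x {y z} → y ≡ 0ℚ → z ≡ 0ℚ → x * (y - z) ≡ 0ℚ
      x*[0-0] x refl refl = *-zeroʳ x
      x*[y-0] : ∀ x y {z} → z ≡ 0ℚ → x * (y - z) ≡ x * y
      x*[y-0] x y refl = cong (x *_) (+-identityʳ y)
      x*[0-y] : ∀ x {y} z → y ≡ 0ℚ → x * (y - z) ≡ - (x * z)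
      x*[0-y] x z refl = trans (cong (x *_) (+-identityˡ (- z))) (sym (neg-distribʳ-* x z))

    cV≡0 : ∀ i₀ → cV i₀ ≡ 0ℚ
    cV≡0 i₀ = begin
      cV i₀                                          ≡⟨ +-identityˡ (cV i₀) ⟨
      0ℚ + cV i₀                                     ≡⟨ cong₂ _+_ atV₀ atW₀ ⟨
      edgesAtV₀ (V (suc i₀)) + edgesAtW₀ (V (suc i₀)) ≡⟨ edgesAtV₀+edgesAtW₀≡0 (V (suc i₀)) ⟩
      0ℚ                                             ∎
      where
      atV₀ : edgesAtV₀ (V (suc i₀)) ≡ 0ℚ
      atV₀ = Σℚ-zero (λ j → x*[0-0] (cW j) (e-offDiag (V zero) (V (suc i₀)) (Fin.0≢1+n ∘ V-injective))
                                          (e-WV (suc i₀) j))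
      atW₀ : edgesAtW₀ (V (suc i₀)) ≡ cV i₀
      atW₀ = trans (Σℚ-cong (λ i → x*[y-0] (cV i) (e (V (suc i)) (V (suc i₀))) (e-WV (suc i₀) zero)))
                   (Σℚ-δ (Fin.suc-injective ∘ V-injective) cV i₀)

    cW≡0 : ∀ j₀ → cW j₀ ≡ 0ℚ
    cW≡0 j₀ = neg-injective (begin
      - cW j₀                               ≡⟨ +-identityʳ (- cW j₀) ⟨
      - cW j₀ + 0ℚ                          ≡⟨ cong₂ _+_ atV₀ atW₀ ⟨
      edgesAtV₀ (W j₀) + edgesAtW₀ (W j₀)   ≡⟨ edgesAtV₀+edgesAtW₀≡0 (W j₀) ⟩
      0ℚ                                    ∎)
      where
      atV₀ : edgesAtV₀ (W j₀) ≡ - cW j₀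
      atV₀ = begin
        edgesAtV₀ (W j₀)                     ≡⟨ Σℚ-cong (λ j → x*[0-y] (cW j) (e (W j) (W j₀)) (e-VW zero j₀)) ⟩
        Σℚ (λ j → - (cW j * e (W j) (W j₀))) ≡⟨ Σℚ-neg (λ j → cW j * e (W j) (W j₀)) ⟩
        - Σℚ (λ j → cW j * e (W j) (W j₀))   ≡⟨ cong -_ (Σℚ-δ W-injective cW j₀) ⟩
        - cW j₀                              ∎
      atW₀ : edgesAtW₀ (W j₀) ≡ 0ℚ
      atW₀ = Σℚ-zero (λ i → trans (cong (_* (e (V (suc i)) (W j₀) - e (W zero) (W j₀))) (cV≡0 i))
                                  (*-zeroˡ (e (V (suc i)) (W j₀) - e (W zero) (W j₀))))

    c≡0 : ∀ k → c k ≡ 0ℚ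
    c≡0 k with Fin.splitAt b k in eq
    ... | inj₁ j = trans (cong c (sym (Fin.splitAt⁻¹-↑ˡ eq))) (cW≡0 j)
    ... | inj₂ i = trans (cong c (sym (Fin.splitAt⁻¹-↑ʳ eq))) (cV≡0 i)

  tree-LinIndep : LinIndep tree
  tree-LinIndep = TreeRelation.c≡0

  a+b≤2+b′+a′ : a ℕ.+ b ℕ.≤ suc (suc (b′ ℕ.+ a′))
  a+b≤2+b′+a′ = ℕ.≤-reflexive (cong suc (trans (ℕ.+-suc a′ b′) (cong suc (ℕ.+-comm a′ b′))))

  P-HasAffIndep : HasAffIndep PK (suc (b ℕ.+ a′))
  P-HasAffIndep = (λ _ → 0ℚ) ∷ tree , point∈P , AffIndep-0∷ {p = tree} tree-LinIndep
    where
    point∈P : ∀ k → PK (((λ _ → 0ℚ) ∷ tree) k)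
    point∈P zero    = 0∈P (zero , zero , refl , refl)
    point∈P (suc k) = generator-∈P _ (generator-VW (treeV k) (treeW k))

  P-¬HasAffIndep : ¬ HasAffIndep PK (suc (suc (b ℕ.+ a′)))
  P-¬HasAffIndep = ¬HasAffIndep-⊥ PK one (V zero) refl P⊥one a+b≤2+b′+a′

  data TightEdge (h : Vecℚ (a ℕ.+ b)) (β : ℚ) (i : Fin a) (j : Fin b) : Set where
    tightVW : h (V i) - h (W j) ≡ β → TightEdge h β i j
    tightWV : h (W j) - h (V i) ≡ β → TightEdge h β i j

  module _ {h : Vecℚ (a ℕ.+ b)} {β : ℚ} {i : Fin a} {j : Fin b} where

    tightPoint : TightEdge h β i j → Vecℚ (a ℕ.+ b)
    tightPoint (tightVW _) = e (V i) -ᵛ e (W j)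
    tightPoint (tightWV _) = e (W j) -ᵛ e (V i)

    tightPoint-∈Face : (t : TightEdge h β i j) → Face PK h β (tightPoint t)
    tightPoint-∈Face (tightVW tight) = generator-∈P _ (generator-VW i j) , trans (⟨⟩-edge h (V i) (W j)) tight
    tightPoint-∈Face (tightWV tight) = generator-∈P _ (generator-WV i j) , trans (⟨⟩-edge h (W j) (V i)) tight

    orientation : TightEdge h β i j → ℚ
    orientation (tightVW _) = 1ℚ
    orientation (tightWV _) = - 1ℚ

    orientation≢0 : (t : TightEdge h β i j) → orientation t ≢ 0ℚ
    orientation≢0 (tightVW _) = 1≢0
    orientation≢0 (tightWV _) = -1≢0

    tightPoint-edge : (t : TightEdge h β i j) (u : Fin (a ℕ.+ b)) →
                      tightPoint t u ≡ orientation t * (e (V i) u - e (W j) u)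
    tightPoint-edge (tightVW _) u = sym (*-identityˡ _)
    tightPoint-edge (tightWV _) u = flip (e (V i) u) (e (W j) u)
      where
      flip : ∀ x y → y - x ≡ - 1ℚ * (x - y)
      flip = solve-∀ ℚ-ring

  facet-criterion : (h : Vecℚ (a ℕ.+ b)) (β : ℚ) → Valid PK h β → β ≢ 0ℚ →
                    (∀ i j → TightEdge h β i j) → DefinesFacet PK h β
  facet-criterion h β valid β≢0 tight =
    valid , b′ ℕ.+ a′ , (P-HasAffIndep , P-¬HasAffIndep) , (face-indep , face-¬indep)
    where
    tight-tree : ∀ k → TightEdge h β (treeV k) (treeW k)
    tight-tree k = tight (treeV k) (treeW k)
    tight-points : Fin (b ℕ.+ a′) → Vecℚ (a ℕ.+ b)
    tight-points k = tightPoint (tight-tree k)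
    tight-points-LinIndep : LinIndep tight-points
    tight-points-LinIndep = LinIndep-scale {p = tree} {q = tight-points} (orientation ∘ tight-tree)
      (orientation≢0 ∘ tight-tree) (tightPoint-edge ∘ tight-tree) tree-LinIndep
    face-indep : HasAffIndep (Face PK h β) (b ℕ.+ a′)
    face-indep =
      tight-points , tightPoint-∈Face ∘ tight-tree , LinIndep⇒AffIndep {p = tight-points} tight-points-LinIndep
    face-¬indep : ¬ HasAffIndep (Face PK h β) (suc (b ℕ.+ a′))
    face-¬indep = ¬HasAffIndep-⊥₁ (Face PK h β) one (V zero) refl (λ x → P⊥one x ∘ proj₁)
                                  h β β≢0 (λ _ → proj₂) a+b≤2+b′+a′

  UnitDifferences : Vecℚ (a ℕ.+ b) → Set
  UnitDifferences h = ∀ i j → (h (V i) - h (W j) ≡ 1ℚ) ⊎ (h (V i) - h (W j) ≡ - 1ℚ)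

  UnitDifferences⇒DefinesFacet : ∀ {h} → UnitDifferences h → DefinesFacet PK h 1ℚ
  UnitDifferences⇒DefinesFacet {h} unit =
    facet-criterion h 1ℚ (valid-fromGenerators h 1ℚ (EdgeBounds⇒generator-≤ {h} bounds)) 1≢0 tight
    where
    bounds : EdgeBounds h 1ℚ
    bounds i j with unit i j
    ... | inj₁ d≡1  = ≤-reflexive d≡1 , ≤-trans (≤-reflexive (reverse-difference (h (V i)) (h (W j)) d≡1)) -1≤1
    ... | inj₂ d≡-1 = ≤-trans (≤-reflexive d≡-1) -1≤1 , ≤-reflexive (reverse-difference (h (V i)) (h (W j)) d≡-1)
    tight : ∀ i j → TightEdge h 1ℚ i j
    tight i j with unit i j
    ... | inj₁ d≡1  = tightVW d≡1
    ... | inj₂ d≡-1 = tightWV (reverse-difference (h (V i)) (h (W j)) d≡-1)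

  FlatOnV : Vecℚ (a ℕ.+ b) → ℚ → Set
  FlatOnV h β = Σ ℚ λ t → (∀ i → h (V i) ≡ t) × (∀ j → (h (W j) ≡ t + β) ⊎ (h (W j) ≡ t - β))

  FlatOnW : Vecℚ (a ℕ.+ b) → ℚ → Set
  FlatOnW h β = Σ ℚ λ s → (∀ j → h (W j) ≡ s) × (∀ i → (h (V i) ≡ s + β) ⊎ (h (V i) ≡ s - β))

  module FacetShape (h : Vecℚ (a ℕ.+ b)) (β : ℚ) (valid : Valid PK h β) (β≢0 : β ≢ 0ℚ) {m : ℕ}
                    (a+b≤1+m : a ℕ.+ b ℕ.≤ suc m) (face-indep : HasAffIndep (Face PK h β) m) where

    bounds : EdgeBounds h β
    bounds = Valid⇒EdgeBounds {h} valid

    Tight : Fin (a ℕ.+ b) → Fin (a ℕ.+ b) → Set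
    Tight x y = h x - h y ≡ β

    Respects : Vecℚ (a ℕ.+ b) → Set
    Respects C = ∀ i j → (Tight (V i) (W j) → C (V i) ≡ C (W j)) × (Tight (W j) (V i) → C (W j) ≡ C (V i))

    -- A functional constant along tight edges vanishes on the face, along with one; since the
    -- face has a + b - 1 affinely independent points, it must be a multiple of one.
    rigid : (C : Vecℚ (a ℕ.+ b)) (u₀ u₁ : Fin (a ℕ.+ b)) → C u₀ ≡ 0ℚ → C u₁ ≡ 1ℚ → Respects C → ⊥
    rigid C u₀ u₁ Cu₀≡0 Cu₁≡1 respects =
      ¬HasAffIndep-⊥₂ (Face PK h β) one C u₀ u₁ refl Cu₀≡0 Cu₁≡1 (λ x → P⊥one x ∘ proj₁)
        (Face⊥ h C β (EdgeBounds⇒generator-≤ {h} bounds) C⊥tight) h β β≢0 (λ _ → proj₂) a+b≤1+m face-indep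
      where
      C⊥tight : ∀ g → Generator (K a b) g → ⟨ h , g ⟩ ≡ β → ⟨ C , g ⟩ ≡ 0ℚ
      C⊥tight g g-gen hg≡β with generator-cases g-gen
      ... | i , j , inj₁ refl = trans (⟨⟩-edge C (V i) (W j))
        (p≡q⇒p-q≡0 (proj₁ (respects i j) (trans (sym (⟨⟩-edge h (V i) (W j))) hg≡β)))
      ... | i , j , inj₂ refl = trans (⟨⟩-edge C (W j) (V i))
        (p≡q⇒p-q≡0 (proj₂ (respects i j) (trans (sym (⟨⟩-edge h (W j) (V i))) hg≡β)))

    NoTightEdgeAt : Fin (a ℕ.+ b) → Set
    NoTightEdgeAt x = ∀ i j → Tight (V i) (W j) ⊎ Tight (W j) (V i) → V i ≢ x × W j ≢ x

    ¬NoTightEdgeAt : ∀ x y → x ≢ y → ¬ NoTightEdgeAt x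
    ¬NoTightEdgeAt x y x≢y none = rigid (e x) y x (e-offDiag x y x≢y) (e-diag x) respects
      where
      both-zero : ∀ {u w} → u ≢ x → w ≢ x → e x u ≡ e x w
      both-zero u≢x w≢x = trans (e-offDiag x _ (u≢x ∘ sym)) (sym (e-offDiag x _ (w≢x ∘ sym)))
      respects : Respects (e x)
      respects i j = (λ tight → both-zero (proj₁ (none i j (inj₁ tight))) (proj₂ (none i j (inj₁ tight)))) ,
                     (λ tight → both-zero (proj₂ (none i j (inj₂ tight))) (proj₁ (none i j (inj₂ tight))))

    levels-W : (t : ℚ) → (∀ i → h (V i) ≡ t) → ∀ j₀ → (h (W j₀) ≡ t + β) ⊎ (h (W j₀) ≡ t - β)
    levels-W t hV≡t j₀ with h (W j₀) ≟ t + β | h (W j₀) ≟ t - β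
    ... | yes up | _        = inj₁ up
    ... | no _   | yes down = inj₂ down
    ... | no ¬up | no ¬down = ⊥-elim (¬NoTightEdgeAt (W j₀) (V zero) (V≢W zero j₀ ∘ sym) none)
      where
      below : ∀ {i j} → Tight (V i) (W j) → h (W j) ≡ t - β
      below {i} {j} tight = trans (p-q≡r⇒q≡p-r (h (V i)) (h (W j)) tight) (cong (_- β) (hV≡t i))
      above : ∀ {i j} → Tight (W j) (V i) → h (W j) ≡ t + β
      above {i} {j} tight = trans (q-p≡r⇒q≡p+r (h (V i)) (h (W j)) tight) (cong (_+ β) (hV≡t i))
      none : NoTightEdgeAt (W j₀)
      none i j (inj₁ tight) = V≢W i j₀ , λ Wj≡Wj₀ → ¬down (subst (λ w → h w ≡ t - β) Wj≡Wj₀ (below tight))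
      none i j (inj₂ tight) = V≢W i j₀ , λ Wj≡Wj₀ → ¬up (subst (λ w → h w ≡ t + β) Wj≡Wj₀ (above tight))

    levels-V : (s : ℚ) → (∀ j → h (W j) ≡ s) → ∀ i₀ → (h (V i₀) ≡ s + β) ⊎ (h (V i₀) ≡ s - β)
    levels-V s hW≡s i₀ with h (V i₀) ≟ s + β | h (V i₀) ≟ s - β
    ... | yes up | _        = inj₁ up
    ... | no _   | yes down = inj₂ down
    ... | no ¬up | no ¬down = ⊥-elim (¬NoTightEdgeAt (V i₀) (W zero) (V≢W i₀ zero) none)
      where
      above : ∀ {i j} → Tight (V i) (W j) → h (V i) ≡ s + β
      above {i} {j} tight = trans (q-p≡r⇒q≡p+r (h (W j)) (h (V i)) tight) (cong (_+ β) (hW≡s j))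
      below : ∀ {i j} → Tight (W j) (V i) → h (V i) ≡ s - β
      below {i} {j} tight = trans (p-q≡r⇒q≡p-r (h (W j)) (h (V i)) tight) (cong (_- β) (hW≡s j))
      none : NoTightEdgeAt (V i₀)
      none i j (inj₁ tight) = (λ Vi≡Vi₀ → ¬up (subst (λ v → h v ≡ s + β) Vi≡Vi₀ (above tight))) , V≢W i₀ j ∘ sym
      none i j (inj₂ tight) = (λ Vi≡Vi₀ → ¬down (subst (λ v → h v ≡ s - β) Vi≡Vi₀ (below tight))) , V≢W i₀ j ∘ sym

    iₘ : Fin a
    iₘ = proj₁ (argmax (h ∘ V))
    M : ℚ
    M = h (V iₘ)
    ≤M : ∀ i → h (V i) ≤ M
    ≤M = proj₂ (argmax (h ∘ V))

    jₘ : Fin b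
    jₘ = proj₁ (argmin (h ∘ W))
    μ : ℚ
    μ = h (W jₘ)
    μ≤ : ∀ j → μ ≤ h (W j)
    μ≤ = proj₂ (argmin (h ∘ W))

    -- The indicator C of {v : h v = M} ∪ {w : h w = μ} is constant along tight edges: a tight
    -- edge v → w realises β ≥ M - μ, and a tight edge w → v touches neither extremal set.
    module ExtremalIndicator {iₗ : Fin a} {jₕ : Fin b} (hViₗ≢M : h (V iₗ) ≢ M) (hWjₕ≢μ : h (W jₕ) ≢ μ) where

      C : Vecℚ (a ℕ.+ b)
      C = (λ i → 𝟙 (h (V i) ≟ M)) ++ (λ j → 𝟙 (h (W j) ≟ μ))

      C-V : ∀ i → C (V i) ≡ 𝟙 (h (V i) ≟ M)
      C-V = lookup-++ˡ (λ i → 𝟙 (h (V i) ≟ M)) (λ j → 𝟙 (h (W j) ≟ μ))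

      C-W : ∀ j → C (W j) ≡ 𝟙 (h (W j) ≟ μ)
      C-W = lookup-++ʳ (λ i → 𝟙 (h (V i) ≟ M)) (λ j → 𝟙 (h (W j) ≟ μ))

      tightVW⇒extremal : ∀ {i j} → Tight (V i) (W j) → h (V i) ≡ M × h (W j) ≡ μ
      tightVW⇒extremal {i} {j} tight =
        squeeze (≤M i) (μ≤ j) (≤-trans (proj₁ (bounds iₘ jₘ)) (≤-reflexive (sym tight)))

      tightWV⇒¬max : ∀ {i j} → Tight (W j) (V i) → h (V i) ≢ M
      tightWV⇒¬max {i} {j} tight hVi≡M = hViₗ≢M (≤-antisym (≤M iₗ) (-cancelˡ-≤ {r = h (W j)}
        (≤-trans (proj₂ (bounds iₗ j)) (≤-reflexive (trans (sym tight) (cong (λ x → h (W j) - x) hVi≡M))))))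

      tightWV⇒¬min : ∀ {i j} → Tight (W j) (V i) → h (W j) ≢ μ
      tightWV⇒¬min {i} {j} tight hWj≡μ = hWjₕ≢μ (≤-antisym (-cancelʳ-≤
        (≤-trans (proj₂ (bounds i jₕ)) (≤-reflexive (trans (sym tight) (cong (_- h (V i)) hWj≡μ))))) (μ≤ jₕ))

      respects : Respects C
      respects i j =
        (λ tight → trans (C-V i) (trans (𝟙-yes (proj₁ (tightVW⇒extremal tight)))
                                        (sym (trans (C-W j) (𝟙-yes (proj₂ (tightVW⇒extremal tight))))))) ,
        (λ tight → trans (C-W j) (trans (𝟙-no (tightWV⇒¬min tight))
                                        (sym (trans (C-V i) (𝟙-no (tightWV⇒¬max tight))))))

      absurd : ⊥
      absurd = rigid C (V iₗ) (V iₘ) (trans (C-V iₗ) (𝟙-no hViₗ≢M)) (trans (C-V iₘ) (𝟙-yes {M} refl)) respects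

    ¬nonconstant : (∃ λ i → h (V i) ≢ h (V zero)) → (∃ λ j → h (W j) ≢ h (W zero)) → ⊥
    ¬nonconstant (_ , hVi₁≢hV₀) (_ , hWj₁≢hW₀) with avoids (h ∘ V) hVi₁≢hV₀ M | avoids (h ∘ W) hWj₁≢hW₀ μ
    ... | _ , hViₗ≢M | _ , hWjₕ≢μ = ExtremalIndicator.absurd hViₗ≢M hWjₕ≢μ

    flat : FlatOnV h β ⊎ FlatOnW h β
    flat with Fin.all? (λ i → h (V i) ≟ h (V zero)) | Fin.all? (λ j → h (W j) ≟ h (W zero))
    ... | yes V-const | _           = inj₁ (h (V zero) , V-const , levels-W (h (V zero)) V-const)
    ... | no _        | yes W-const = inj₂ (h (W zero) , W-const , levels-V (h (W zero)) W-const)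
    ... | no ¬V-const | no ¬W-const = ⊥-elim (¬nonconstant
      (Fin.¬∀⟶∃¬ a _ (λ i → h (V i) ≟ h (V zero)) ¬V-const) (Fin.¬∀⟶∃¬ b _ (λ j → h (W j) ≟ h (W zero)) ¬W-const))

  DefinesFacet⇒Flat : ∀ {h β} → DefinesFacet PK h β → FlatOnV h β ⊎ FlatOnW h β
  DefinesFacet⇒Flat {h} {β} facet@(valid , d , (_ , ¬P-indep) , (face-indep , _)) =
    FacetShape.flat h β valid (DefinesFacet⇒≢0 h β facet) a+b≤2+d face-indep
    where
    a+b≤2+d : a ℕ.+ b ℕ.≤ suc (suc d)
    a+b≤2+d = ℕ.≤-trans a+b≤2+b′+a′ (HasAffIndep-bound {S = PK} ¬P-indep P-HasAffIndep)

  Flat⇒UnitDifferences : ∀ {h} → FlatOnV h 1ℚ ⊎ FlatOnW h 1ℚ → UnitDifferences h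
  Flat⇒UnitDifferences {h} (inj₁ (t , hV≡t , hW)) i j with hW j
  ... | inj₁ up   = inj₂ (trans (cong₂ _-_ (hV≡t i) up) (t-[t+1] t))
    where
    t-[t+1] : ∀ t → t - (t + 1ℚ) ≡ - 1ℚ
    t-[t+1] = solve-∀ ℚ-ring
  ... | inj₂ down = inj₁ (trans (cong₂ _-_ (hV≡t i) down) (t-[t-1] t))
    where
    t-[t-1] : ∀ t → t - (t - 1ℚ) ≡ 1ℚ
    t-[t-1] = solve-∀ ℚ-ring
  Flat⇒UnitDifferences {h} (inj₂ (s , hW≡s , hV)) i j with hV i
  ... | inj₁ up   = inj₁ (trans (cong₂ _-_ up (hW≡s j)) ([s+1]-s s))
    where
    [s+1]-s : ∀ s → (s + 1ℚ) - s ≡ 1ℚ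
    [s+1]-s = solve-∀ ℚ-ring
  ... | inj₂ down = inj₂ (trans (cong₂ _-_ down (hW≡s j)) ([s-1]-s s))
    where
    [s-1]-s : ∀ s → (s - 1ℚ) - s ≡ - 1ℚ
    [s-1]-s = solve-∀ ℚ-ring

  DefinesFacet⇔Flat : (h : Vecℚ (a ℕ.+ b)) → DefinesFacet PK h 1ℚ ⇔ (FlatOnV h 1ℚ ⊎ FlatOnW h 1ℚ)
  DefinesFacet⇔Flat h =
    mk⇔ (DefinesFacet⇒Flat {h}) (UnitDifferences⇒DefinesFacet {h} ∘ Flat⇒UnitDifferences {h})

  ≗-byVertices : {f g : Vecℚ (a ℕ.+ b)} → (∀ i → f (V i) ≡ g (V i)) → (∀ j → f (W j) ≡ g (W j)) →
                 ∀ u → f u ≡ g u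
  ≗-byVertices onV onW u with vertex-cases u
  ... | inj₁ (i , refl) = onV i
  ... | inj₂ (j , refl) = onW j

  sign : Fin 2 → ℚ
  sign zero       = - 1ℚ
  sign (suc zero) = 1ℚ

  sign-injective : ∀ c c′ → sign c ≡ sign c′ → c ≡ c′
  sign-injective zero       zero       _  = refl
  sign-injective zero       (suc zero) ()
  sign-injective (suc zero) zero       ()
  sign-injective (suc zero) (suc zero) _  = refl

  sign-opposite : ∀ c → sign (Fin.opposite c) ≡ - sign c
  sign-opposite zero       = refl
  sign-opposite (suc zero) = refl

  choose : {A : Set} → Dec A → Fin 2
  choose (yes _) = suc zero
  choose (no _)  = zero

  level-sign : ∀ {x} t β → (x ≡ t + β) ⊎ (x ≡ t - β) → x ≡ t + β * sign (choose (x ≟ t + β))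
  level-sign {x} t β level with x ≟ t + β | level
  ... | yes up   | _         = trans up (times-one t β)
    where
    times-one : ∀ t β → t + β ≡ t + β * 1ℚ
    times-one = solve-∀ ℚ-ring
  ... | no ¬up   | inj₁ up   = contradiction up ¬up
  ... | no _     | inj₂ down = trans down (times-minus-one t β)
    where
    times-minus-one : ∀ t β → t - β ≡ t + β * - 1ℚ
    times-minus-one = solve-∀ ℚ-ring

  wPattern : (Fin b → Fin 2) → Vecℚ (a ℕ.+ b)
  wPattern σ = (λ (_ : Fin a) → 0ℚ) ++ (sign ∘ σ)

  vPattern : (Fin a → Fin 2) → Vecℚ (a ℕ.+ b)
  vPattern τ = (sign ∘ τ) ++ (λ (_ : Fin b) → 0ℚ)

  wPattern-V : ∀ σ i → wPattern σ (V i) ≡ 0ℚ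
  wPattern-V σ = lookup-++ˡ (λ (_ : Fin a) → 0ℚ) (sign ∘ σ)

  wPattern-W : ∀ σ j → wPattern σ (W j) ≡ sign (σ j)
  wPattern-W σ = lookup-++ʳ (λ (_ : Fin a) → 0ℚ) (sign ∘ σ)

  vPattern-V : ∀ τ i → vPattern τ (V i) ≡ sign (τ i)
  vPattern-V τ = lookup-++ˡ (sign ∘ τ) (λ (_ : Fin b) → 0ℚ)

  vPattern-W : ∀ τ j → vPattern τ (W j) ≡ 0ℚ
  vPattern-W τ = lookup-++ʳ (sign ∘ τ) (λ (_ : Fin b) → 0ℚ)

  wPattern-difference : ∀ σ i j → wPattern σ (V i) - wPattern σ (W j) ≡ - sign (σ j)
  wPattern-difference σ i j = trans (cong₂ _-_ (wPattern-V σ i) (wPattern-W σ j)) (+-identityˡ (- sign (σ j)))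

  vPattern-difference : ∀ τ i j → vPattern τ (V i) - vPattern τ (W j) ≡ sign (τ i)
  vPattern-difference τ i j = trans (cong₂ _-_ (vPattern-V τ i) (vPattern-W τ j)) (+-identityʳ (sign (τ i)))

  wPattern-unit : ∀ σ → UnitDifferences (wPattern σ)
  wPattern-unit σ i j with σ j in σj
  ... | zero     = inj₁ (trans (wPattern-difference σ i j) (cong (-_ ∘ sign) σj))
  ... | suc zero = inj₂ (trans (wPattern-difference σ i j) (cong (-_ ∘ sign) σj))

  vPattern-unit : ∀ τ → UnitDifferences (vPattern τ)
  vPattern-unit τ i j with τ i in τi
  ... | zero     = inj₂ (trans (vPattern-difference τ i j) (cong sign τi))
  ... | suc zero = inj₁ (trans (vPattern-difference τ i j) (cong sign τi))

  -- The face of a unit-difference functional records, for every edge, which orientation is tight.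
  sameFace⇒sameDifferences : ∀ {h h′} → UnitDifferences h → SameSet (Face PK h 1ℚ) (Face PK h′ 1ℚ) →
                             ∀ i j → h (V i) - h (W j) ≡ h′ (V i) - h′ (W j)
  sameFace⇒sameDifferences {h} {h′} unit same i j with unit i j
  ... | inj₁ d≡1  = trans d≡1 (sym h′-difference≡1)
    where
    h′-difference≡1 : h′ (V i) - h′ (W j) ≡ 1ℚ
    h′-difference≡1 = trans (sym (⟨⟩-edge h′ (V i) (W j)))
                            (proj₂ (proj₁ (same _) (tightPoint-∈Face (tightVW {h} d≡1))))
  ... | inj₂ d≡-1 = trans d≡-1 (sym (reverse-difference (h′ (W j)) (h′ (V i)) h′-reverse≡1))
    where
    reverse≡1 : h (W j) - h (V i) ≡ 1ℚ
    reverse≡1 = reverse-difference (h (V i)) (h (W j)) d≡-1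
    h′-reverse≡1 : h′ (W j) - h′ (V i) ≡ 1ℚ
    h′-reverse≡1 = trans (sym (⟨⟩-edge h′ (W j) (V i)))
                         (proj₂ (proj₁ (same _) (tightPoint-∈Face (tightWV {h} reverse≡1))))

  IsConstant : (Fin a → Fin 2) → Set
  IsConstant τ = ∀ i → τ i ≡ τ zero

  mixed⇒IsConstant : ∀ σ τ → SameSet (Face PK (wPattern σ) 1ℚ) (Face PK (vPattern τ) 1ℚ) → IsConstant τ
  mixed⇒IsConstant σ τ same i = sign-injective _ _ (trans (sign≡ i) (sym (sign≡ zero)))
    where
    sign≡ : ∀ i → sign (τ i) ≡ - sign (σ zero)
    sign≡ i = begin
      sign (τ i)
        ≡⟨ vPattern-difference τ i zero ⟨
      vPattern τ (V i) - vPattern τ (W zero)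
        ≡⟨ sameFace⇒sameDifferences {wPattern σ} {vPattern τ} (wPattern-unit σ) same i zero ⟨
      wPattern σ (V i) - wPattern σ (W zero)
        ≡⟨ wPattern-difference σ i zero ⟩
      - sign (σ zero)
        ∎

  -- The non-constant sign vectors on V, enumerated by Fin (2 ^ a ∸ 2): code all sign vectors by
  -- Fin (2 + (2 ^ a ∸ 2)) and puncture the codes of the two constant ones.
  module NonConstant where

    open FinCodes using (finToFun-injective; module TwoPunctures)

    M : ℕ
    M = 2 ^ a ∸ 2

    2≤2^a : 2 ℕ.≤ 2 ^ a
    2≤2^a = ℕ.^-monoʳ-≤ 2 {1} {a} (s≤s z≤n)

    2+M≡2^a : 2 ℕ.+ M ≡ 2 ^ a
    2+M≡2^a = ℕ.m+[n∸m]≡n 2≤2^a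

    code : (Fin a → Fin 2) → Fin (2 ℕ.+ M)
    code τ = Fin.cast (sym 2+M≡2^a) (Fin.funToFin τ)

    decode : Fin (2 ℕ.+ M) → Fin a → Fin 2
    decode k = Fin.finToFun (Fin.cast 2+M≡2^a k)

    decode-code : ∀ τ i → decode (code τ) i ≡ τ i
    decode-code τ i = trans (cong (λ k → Fin.finToFun k i) (Fin.cast-involutive 2+M≡2^a (sym 2+M≡2^a) _))
                            (Fin.finToFun-funToFin τ i)

    decode-injective : ∀ k k′ → (∀ i → decode k i ≡ decode k′ i) → k ≡ k′
    decode-injective k k′ eq = begin
      k                                             ≡⟨ Fin.cast-involutive (sym 2+M≡2^a) 2+M≡2^a k ⟨
      Fin.cast (sym 2+M≡2^a) (Fin.cast 2+M≡2^a k)   ≡⟨ cong (Fin.cast (sym 2+M≡2^a)) (finToFun-injective _ _ eq) ⟩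
      Fin.cast (sym 2+M≡2^a) (Fin.cast 2+M≡2^a k′)  ≡⟨ Fin.cast-involutive (sym 2+M≡2^a) 2+M≡2^a k′ ⟩
      k′                                            ∎

    code-const : Fin 2 → Fin (2 ℕ.+ M)
    code-const c = code (λ _ → c)

    code-const≡⇒IsConstant : ∀ τ c → code-const c ≡ code τ → IsConstant τ
    code-const≡⇒IsConstant τ c eq i = trans (sym (τ≡c i)) (τ≡c zero)
      where
      τ≡c : ∀ i → c ≡ τ i
      τ≡c i = trans (sym (decode-code (λ _ → c) i)) (trans (cong (λ k → decode k i) eq) (decode-code τ i))

    code-const-distinct : code-const zero ≢ code-const (suc zero)
    code-const-distinct eq = Fin.0≢1+n (begin
      zero                               ≡⟨ decode-code (λ _ → zero) zero ⟨
      decode (code-const zero) zero      ≡⟨ cong (λ k → decode k zero) eq ⟩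
      decode (code-const (suc zero)) zero ≡⟨ decode-code (λ _ → suc zero) zero ⟩
      suc zero                           ∎)

    open TwoPunctures code-const-distinct

    nonConstant : Fin M → Fin a → Fin 2
    nonConstant j = decode (punchIn₂ j)

    nonConstant-injective : ∀ j j′ → (∀ i → nonConstant j i ≡ nonConstant j′ i) → j ≡ j′
    nonConstant-injective j j′ eq = punchIn₂-injective j j′ (decode-injective _ _ eq)

    nonConstant-¬IsConstant : ∀ j → ¬ IsConstant (nonConstant j)
    nonConstant-¬IsConstant j const = constant-at (nonConstant j zero) refl
      where
      ≡code-const : ∀ c → nonConstant j zero ≡ c → punchIn₂ j ≡ code-const c
      ≡code-const c τ₀≡c =
        decode-injective _ _ (λ i → trans (const i) (trans τ₀≡c (sym (decode-code (λ _ → c) i))))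
      constant-at : ∀ c → nonConstant j zero ≡ c → ⊥
      constant-at zero       τ₀≡c = punchIn₂≢k₀ j (≡code-const zero τ₀≡c)
      constant-at (suc zero) τ₀≡c = punchIn₂≢k₁ j (≡code-const (suc zero) τ₀≡c)

    nonConstant-surjective : ∀ τ → ¬ IsConstant τ → ∃ λ j → ∀ i → nonConstant j i ≡ τ i
    nonConstant-surjective τ ¬const = j , λ i → trans (cong (λ k → decode k i) punchIn₂j≡codeτ) (decode-code τ i)
      where
      preimage : ∃ λ j → punchIn₂ j ≡ code τ
      preimage = punchIn₂-surjective (code τ) (¬const ∘ code-const≡⇒IsConstant τ zero)
                                              (¬const ∘ code-const≡⇒IsConstant τ (suc zero))
      j = proj₁ preimage
      punchIn₂j≡codeτ = proj₂ preimage

  open NonConstant using (M; nonConstant; nonConstant-injective; nonConstant-¬IsConstant; nonConstant-surjective)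

  Index : Set
  Index = Fin (2 ^ b) ⊎ Fin M

  normalForm : Index → Vecℚ (a ℕ.+ b)
  normalForm (inj₁ k) = wPattern (Fin.finToFun k)
  normalForm (inj₂ j) = vPattern (nonConstant j)

  normalForm-unit : ∀ ι → UnitDifferences (normalForm ι)
  normalForm-unit (inj₁ k) = wPattern-unit (Fin.finToFun k)
  normalForm-unit (inj₂ j) = vPattern-unit (nonConstant j)

  normalForm-injective : ∀ ι ι′ → SameSet (Face PK (normalForm ι) 1ℚ) (Face PK (normalForm ι′) 1ℚ) → ι ≡ ι′
  normalForm-injective (inj₁ k) (inj₁ k′) same = cong inj₁ (FinCodes.finToFun-injective {2} {b} k k′ σ≗σ′)
    where
    σ = Fin.finToFun k
    σ′ = Fin.finToFun k′
    σ≗σ′ : ∀ j → σ j ≡ σ′ j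
    σ≗σ′ j = sign-injective (σ j) (σ′ j) (neg-injective (begin
      - sign (σ j)
        ≡⟨ wPattern-difference σ zero j ⟨
      wPattern σ (V zero) - wPattern σ (W j)
        ≡⟨ sameFace⇒sameDifferences {wPattern σ} {wPattern σ′} (wPattern-unit σ) same zero j ⟩
      wPattern σ′ (V zero) - wPattern σ′ (W j)
        ≡⟨ wPattern-difference σ′ zero j ⟩
      - sign (σ′ j)
        ∎))
  normalForm-injective (inj₂ j) (inj₂ j′) same = cong inj₂ (nonConstant-injective j j′ τ≗τ′)
    where
    τ = nonConstant j
    τ′ = nonConstant j′
    τ≗τ′ : ∀ i → τ i ≡ τ′ i
    τ≗τ′ i = sign-injective (τ i) (τ′ i) (begin
      sign (τ i)
        ≡⟨ vPattern-difference τ i zero ⟨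
      vPattern τ (V i) - vPattern τ (W zero)
        ≡⟨ sameFace⇒sameDifferences {vPattern τ} {vPattern τ′} (vPattern-unit τ) same i zero ⟩
      vPattern τ′ (V i) - vPattern τ′ (W zero)
        ≡⟨ vPattern-difference τ′ i zero ⟩
      sign (τ′ i)
        ∎)
  normalForm-injective (inj₁ k) (inj₂ j) same =
    ⊥-elim (nonConstant-¬IsConstant j (mixed⇒IsConstant (Fin.finToFun k) (nonConstant j) same))
  normalForm-injective (inj₂ j) (inj₁ k) same =
    ⊥-elim (nonConstant-¬IsConstant j (mixed⇒IsConstant (Fin.finToFun k) (nonConstant j) (SameSet-sym same)))

  Normalises : Vecℚ (a ℕ.+ b) → ℚ → Index → Set
  Normalises h β ι = Σ ℚ λ t → ∀ u → h u ≡ t + β * normalForm ι u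

  wPattern-cong : ∀ {σ σ′} → (∀ j → σ j ≡ σ′ j) → ∀ u → wPattern σ u ≡ wPattern σ′ u
  wPattern-cong {σ} {σ′} σ≗σ′ = ≗-byVertices (λ i → trans (wPattern-V σ i) (sym (wPattern-V σ′ i)))
    (λ j → trans (wPattern-W σ j) (trans (cong sign (σ≗σ′ j)) (sym (wPattern-W σ′ j))))

  wPattern⇒Normalises : ∀ {h β} σ t → (∀ u → h u ≡ t + β * wPattern σ u) → ∃ (Normalises h β)
  wPattern⇒Normalises {β = β} σ t h≗ = inj₁ (Fin.funToFin σ) , t ,
    λ u → trans (h≗ u) (cong (λ x → t + β * x) (wPattern-cong (sym ∘ Fin.finToFun-funToFin σ) u))

  FlatOnV⇒Normalises : ∀ {h β} → FlatOnV h β → ∃ (Normalises h β)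
  FlatOnV⇒Normalises {h} {β} (t , hV≡t , hW) = wPattern⇒Normalises {h} {β} σ t (≗-byVertices onV onW)
    where
    σ : Fin b → Fin 2
    σ j = choose (h (W j) ≟ t + β)
    onV : ∀ i → h (V i) ≡ t + β * wPattern σ (V i)
    onV i = trans (hV≡t i) (trans (x≡x+y*0 t β) (cong (λ x → t + β * x) (sym (wPattern-V σ i))))
    onW : ∀ j → h (W j) ≡ t + β * wPattern σ (W j)
    onW j = trans (level-sign t β (hW j)) (cong (λ x → t + β * x) (sym (wPattern-W σ j)))

  FlatOnW⇒Normalises : ∀ {h β} → FlatOnW h β → ∃ (Normalises h β)
  FlatOnW⇒Normalises {h} {β} (s , hW≡s , hV) = by-constancy (Fin.all? (λ i → τ i Fin.≟ τ zero))
    where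
    τ : Fin a → Fin 2
    τ i = choose (h (V i) ≟ s + β)
    hV≡ : ∀ i → h (V i) ≡ s + β * sign (τ i)
    hV≡ i = level-sign s β (hV i)
    -- For constant τ = c the functional is also (s + β sign c) + β wPattern (opposite c).
    by-constancy : Dec (IsConstant τ) → ∃ (Normalises h β)
    by-constancy (yes const) = wPattern⇒Normalises {h} {β} σ t (≗-byVertices onV onW)
      where
      c = τ zero
      σ : Fin b → Fin 2
      σ _ = Fin.opposite c
      t = s + β * sign c
      onV : ∀ i → h (V i) ≡ t + β * wPattern σ (V i)
      onV i = trans (hV≡ i) (trans (cong (λ x → s + β * sign x) (const i))
                (trans (x≡x+y*0 t β) (cong (λ x → t + β * x) (sym (wPattern-V σ i)))))
      onW : ∀ j → h (W j) ≡ t + β * wPattern σ (W j)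
      onW j = trans (hW≡s j) (trans (shift s β (sign c))
                (cong (λ x → t + β * x) (trans (sym (sign-opposite c)) (sym (wPattern-W σ j)))))
        where
        shift : ∀ s β x → s ≡ (s + β * x) + β * (- x)
        shift = solve-∀ ℚ-ring
    by-constancy (no ¬const) = inj₂ j , s , ≗-byVertices onV onW
      where
      j = proj₁ (nonConstant-surjective τ ¬const)
      nonConstant≗τ = proj₂ (nonConstant-surjective τ ¬const)
      onV : ∀ i → h (V i) ≡ s + β * vPattern (nonConstant j) (V i)
      onV i = trans (hV≡ i) (cong (λ x → s + β * x) (trans (cong sign (sym (nonConstant≗τ i)))
                                                           (sym (vPattern-V (nonConstant j) i))))
      onW : ∀ j′ → h (W j′) ≡ s + β * vPattern (nonConstant j) (W j′)
      onW j′ = trans (hW≡s j′) (trans (x≡x+y*0 s β) (cong (λ x → s + β * x) (sym (vPattern-W (nonConstant j) j′))))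

  DefinesFacet⇒Normalises : ∀ {h β} → DefinesFacet PK h β → ∃ (Normalises h β)
  DefinesFacet⇒Normalises {h} facet with DefinesFacet⇒Flat {h} facet
  ... | inj₁ flatV = FlatOnV⇒Normalises flatV
  ... | inj₂ flatW = FlatOnW⇒Normalises flatW

  facets : HasNFacets PK (2 ^ a ℕ.+ 2 ^ b ∸ 2)
  facets = subst (HasNFacets PK) count
    (HasNFacets-from Fin.+↔⊎ (λ ι → Face PK (normalForm ι) 1ℚ) facet normalForm-injective complete)
    where
    count : 2 ^ b ℕ.+ M ≡ 2 ^ a ℕ.+ 2 ^ b ∸ 2
    count = sym (trans (ℕ.+-∸-comm (2 ^ b) NonConstant.2≤2^a) (ℕ.+-comm M (2 ^ b)))
    facet : ∀ ι → IsFacet PK (Face PK (normalForm ι) 1ℚ)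
    facet ι = normalForm ι , 1ℚ , UnitDifferences⇒DefinesFacet {normalForm ι} (normalForm-unit ι) , λ _ → id , id
    complete : ∀ G → IsFacet PK G → ∃ λ ι → SameSet G (Face PK (normalForm ι) 1ℚ)
    complete G (h , β , h-facet , G≐face) with DefinesFacet⇒Normalises {h} h-facet
    ... | ι , t , h≗ = ι , SameSet-trans G≐face
                              (Face-affine h (normalForm ι) t β (DefinesFacet⇒≢0 h β h-facet) h≗)

module FromInteger where

  open Rationals
  open import Data.Rational using (↥_; toℚᵘ)
  open import Data.Rational.Properties using (↥-/; toℚᵘ-injective; toℚᵘ-fromℚᵘ; toℚᵘ-homo-+)
  open import Data.Rational.Unnormalised as ℚᵘ using (mkℚᵘ; *≡*)
  open import Data.Rational.Unnormalised.Properties using (+-cong; module ≃-Reasoning)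
  open import Data.Integer as ℤ using (ℤ)
  open import Data.Integer.Properties using (*-identityʳ)
  open import Data.Integer.GCD using (gcd-zeroʳ)
  open import Data.Integer.Tactic.RingSolver using () renaming (solve-∀ to ℤ-solve-∀)
  open import Tactic.RingSolver using (solve-∀)

  fromℤ : ℤ → ℚ
  fromℤ x = x Data.Rational./ 1

  fromℤ-injective : ∀ {x y} → fromℤ x ≡ fromℤ y → x ≡ y
  fromℤ-injective {x} {y} eq = trans (sym (↥-fromℤ x)) (trans (cong ↥_ eq) (↥-fromℤ y))
    where
    ↥-fromℤ : ∀ x → ↥ fromℤ x ≡ x
    ↥-fromℤ x = trans (sym (*-identityʳ _)) (trans (cong (↥ fromℤ x ℤ.*_) (sym (gcd-zeroʳ x))) (↥-/ x 1))

  fromℤ-+ : ∀ x y → fromℤ (x ℤ.+ y) ≡ fromℤ x + fromℤ y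
  fromℤ-+ x y = toℚᵘ-injective (begin
    toℚᵘ (fromℤ (x ℤ.+ y))                ≈⟨ toℚᵘ-fromℚᵘ (mkℚᵘ (x ℤ.+ y) 0) ⟩
    mkℚᵘ (x ℤ.+ y) 0                      ≈⟨ *≡* (distrib x y) ⟩
    mkℚᵘ x 0 ℚᵘ.+ mkℚᵘ y 0                ≈⟨ +-cong (toℚᵘ-fromℚᵘ (mkℚᵘ x 0)) (toℚᵘ-fromℚᵘ (mkℚᵘ y 0)) ⟨
    toℚᵘ (fromℤ x) ℚᵘ.+ toℚᵘ (fromℤ y)    ≈⟨ toℚᵘ-homo-+ (fromℤ x) (fromℤ y) ⟨
    toℚᵘ (fromℤ x + fromℤ y)              ∎)
    where
    open ≃-Reasoning
    distrib : ∀ x y → (x ℤ.+ y) ℤ.* ℤ.+ 1 ≡ (x ℤ.* ℤ.+ 1 ℤ.+ y ℤ.* ℤ.+ 1) ℤ.* ℤ.+ 1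
    distrib = ℤ-solve-∀

  fromℤ-level : ∀ x c r → x ℤ.+ c ≡ r → fromℤ x ≡ fromℤ (ℤ.- c) + fromℤ r
  fromℤ-level x c r refl = trans (cong fromℤ (shift x c)) (fromℤ-+ (ℤ.- c) (x ℤ.+ c))
    where
    shift : ∀ x c → x ≡ ℤ.- c ℤ.+ (x ℤ.+ c)
    shift = ℤ-solve-∀

  level-fromℤ : ∀ x y r → fromℤ x ≡ fromℤ y + fromℤ r → x ℤ.+ ℤ.- y ≡ r
  level-fromℤ x y r eq = trans (cong (ℤ._+ ℤ.- y) x≡y+r) (cancel y r)
    where
    x≡y+r : x ≡ y ℤ.+ r
    x≡y+r = fromℤ-injective (trans eq (sym (fromℤ-+ y r)))
    cancel : ∀ y r → y ℤ.+ r ℤ.+ ℤ.- y ≡ r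
    cancel = ℤ-solve-∀

-- The operators of ℤ are opened only from here on: the development above uses those of ℚ.
open import Data.Integer using (ℤ; _+_; +_; -_)

module IntegerNormalForm (a′ b′ : ℕ) where

  open CompleteBipartite a′ b′
  open FromInteger
  open import Data.Rational as ℚ using (1ℚ)
  open import Data.Rational.Properties using (+-identityʳ)

  IntegerNormalForm : (Fin (a ℕ.+ b) → ℤ) → Set
  IntegerNormalForm f = Σ ℤ λ c →
    (((i : Fin a) → f (V i) + c ≡ + 0) × ((j : Fin b) → (f (W j) + c ≡ + 1) ⊎ (f (W j) + c ≡ - (+ 1)))) ⊎
    (((j : Fin b) → f (W j) + c ≡ + 0) × ((i : Fin a) → (f (V i) + c ≡ + 1) ⊎ (f (V i) + c ≡ - (+ 1))))

  Flat⇔IntegerNormalForm : (f : Fin (a ℕ.+ b) → ℤ) →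
    (FlatOnV (toℚᵛ f) 1ℚ ⊎ FlatOnW (toℚᵛ f) 1ℚ) ⇔ IntegerNormalForm f
  Flat⇔IntegerNormalForm f = mk⇔ to from
    where
    unflat : ∀ {t} x y → fromℤ x ≡ t → fromℤ y ≡ t → x + - y ≡ + 0
    unflat x y x≡t y≡t = level-fromℤ x y (+ 0) (trans x≡t (trans (sym y≡t) (sym (+-identityʳ _))))
    unlevel : ∀ {t} x y → (fromℤ x ≡ t ℚ.+ 1ℚ) ⊎ (fromℤ x ≡ t ℚ.- 1ℚ) → fromℤ y ≡ t →
              (x + - y ≡ + 1) ⊎ (x + - y ≡ - (+ 1))
    unlevel x y (inj₁ up)   y≡t = inj₁ (level-fromℤ x y (+ 1) (trans up (cong (ℚ._+ 1ℚ) (sym y≡t))))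
    unlevel x y (inj₂ down) y≡t = inj₂ (level-fromℤ x y (- (+ 1)) (trans down (cong (ℚ._- 1ℚ) (sym y≡t))))
    to : FlatOnV (toℚᵛ f) 1ℚ ⊎ FlatOnW (toℚᵛ f) 1ℚ → IntegerNormalForm f
    to (inj₁ (t , fV≡t , fW)) = - f (V zero) , inj₁
      ((λ i → unflat (f (V i)) (f (V zero)) (fV≡t i) (fV≡t zero)) ,
       (λ j → unlevel (f (W j)) (f (V zero)) (fW j) (fV≡t zero)))
    to (inj₂ (s , fW≡s , fV)) = - f (W zero) , inj₂
      ((λ j → unflat (f (W j)) (f (W zero)) (fW≡s j) (fW≡s zero)) ,
       (λ i → unlevel (f (V i)) (f (W zero)) (fV i) (fW≡s zero)))
    flat : ∀ x c → x + c ≡ + 0 → fromℤ x ≡ fromℤ (- c)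
    flat x c x+c≡0 = trans (fromℤ-level x c (+ 0) x+c≡0) (+-identityʳ _)
    level : ∀ x c → (x + c ≡ + 1) ⊎ (x + c ≡ - (+ 1)) →
            (fromℤ x ≡ fromℤ (- c) ℚ.+ 1ℚ) ⊎ (fromℤ x ≡ fromℤ (- c) ℚ.- 1ℚ)
    level x c (inj₁ up)   = inj₁ (fromℤ-level x c (+ 1) up)
    level x c (inj₂ down) = inj₂ (fromℤ-level x c (- (+ 1)) down)
    from : IntegerNormalForm f → FlatOnV (toℚᵛ f) 1ℚ ⊎ FlatOnW (toℚᵛ f) 1ℚ
    from (c , inj₁ (fV , fW)) =
      inj₁ (fromℤ (- c) , (λ i → flat (f (V i)) c (fV i)) , λ j → level (f (W j)) c (fW j))
    from (c , inj₂ (fW , fV)) =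
      inj₂ (fromℤ (- c) , (λ j → flat (f (W j)) c (fW j)) , λ i → level (f (V i)) c (fV i))

proposition3p4 : (a b : ℕ) → a ≥ 1 → b ≥ 1 →
    ((f : Fin (a ℕ.+ b) → ℤ) →
      FacetDefining (K a b) f ⇔
      (Σ ℤ λ c →
        (((i : Fin a) → f (vtx b i) + c ≡ + 0) ×
         ((j : Fin b) → (f (wtx a j) + c ≡ + 1) ⊎ (f (wtx a j) + c ≡ - (+ 1))))
        ⊎
        (((j : Fin b) → f (wtx a j) + c ≡ + 0) ×
         ((i : Fin a) → (f (vtx b i) + c ≡ + 1) ⊎ (f (vtx b i) + c ≡ - (+ 1))))))
    × HasNFacets (P (K a b)) ((2 ^ a) ℕ.+ (2 ^ b) ∸ 2)
proposition3p4 (suc a′) (suc b′) _ _ =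
  (λ f → Flat⇔IntegerNormalForm f ⇔-∘ DefinesFacet⇔Flat (toℚᵛ f)) , facets
  where
  open CompleteBipartite a′ b′
  open IntegerNormalForm a′ b′
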